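{- Let $n,k\ge0$. For every $(S_1,S_2)\in\mathcal{C}_n^k$ the rook placement procedure in the context produces a well-defined placement of $n+k+1$ non-attacking rooks giving a permutation in $\mathcal{E}_n^k$, and the resulting map $\mathcal{C}_n^k\to\mathcal{E}_n^k$ is a bijection.
   Context: Colored symbols $i^r$ (red), $j^b$ (blue), compared within a color by value. $\mathcal{C}_n^k$: pairs of possibly empty strings $(S_1,S_2)$ using each of $1^r,\dots,n^r,1^b,\dots,k^b$ exactly once in total, with $S_1$ (if nonempty) starting blue, $S_2$ (if nonempty) starting red, every maximal same-colored run decreasing. $\mathcal{E}_n^k$: permutations $\lambda$ of $[n+k+1]$ with $\{i:\lambda(i)>i\}=\{1,\dots,n\}$; $\lambda$ is identified with the placement of rooks on an $(n+k+1)\times(n+k+1)$ board in column $i$ (from the left) and row $\lambda(i)$ (from the bottom). Labels: columns $1,\dots,n+k+1$ (left to right) are labeled $n^r,(n-1)^r,\dots,1^r,k^b,\dots,1^b,0^b$; rows from top to bottom are labeled $1^b,2^b,\dots,k^b,0^r,1^r,\dots,n^r$ (so row $\lambda$-value $n+k+1$ is $1^b$ and row value $1$ is $n^r$). Procedure: set $S=S_1\,0^b\,S_2\,0^r=x_1x_2\cdots x_{n+k+2}$. (1) For each pair of adjacent letters of the same color in $S$: if it is $x^ry^r$ place a rook in row $y^r$, column $x^r$; if it is $x^by^b$ place a rook in row $x^b$, column $y^b$. (2) Then for $i=1,2,\dots,n+k+1$ in order: if column $x_i$ already contains a rook, do nothing; otherwise place a rook in column $x_i$ in the topmost row among the rooks-free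 rows whose label has the color different from that of $x_i$. -}

module Defs where

open import Data.Nat using (ℕ; zero; suc; _+_; _∸_; _<_; _≤ᵇ_; _≡ᵇ_)
open import Data.Bool using (Bool; true; false; if_then_else_; _∧_; not)
open import Data.List using (List; []; _∷_; _++_; map; upTo)
open import Data.Bool.ListAction using (any)
open import Data.List.Relation.Binary.Permutation.Propositional using (_↭_)
open import Data.Maybe using (Maybe; just; nothing)
open import Data.Product using (Σ; _×_; _,_)
open import Data.Unit using (⊤)
open import Data.Fin using (Fin; toℕ)
open import Data.Fin.Permutation using (Permutation′; _⟨$⟩ʳ_)
open import Data.List using (allFin)
open import Function.Bundles using (_⇔_)
open import Relation.Binary.PropositionalEquality using (_≡_)

-- Colored symbols: red i = i^r, blue j = j^b

data Color : Set where
  r b : Color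

data Sym : Set where
  red  : ℕ → Sym
  blue : ℕ → Sym

color : Sym → Color
color (red _)  = r
color (blue _) = b

_==C_ : Color → Color → Bool
r ==C r = true
b ==C b = true
_ ==C _ = false

_==S_ : Sym → Sym → Bool
red x  ==S red y  = x ≡ᵇ y
blue x ==S blue y = x ≡ᵇ y
_      ==S _      = false

StartsWith : Color → List Sym → Set
StartsWith c []      = ⊤
StartsWith c (x ∷ _) = color x ≡ c

AdjDecr : Sym → Sym → Set
AdjDecr (red x)  (red y)  = y < x
AdjDecr (blue x) (blue y) = y < x
AdjDecr _        _        = ⊤

-- Every maximal same-colored run is decreasing
-- (i.e. any two adjacent letters of the same color decrease).
RunsDecreasing : List Sym → Set
RunsDecreasing []            = ⊤
RunsDecreasing (x ∷ [])      = ⊤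
RunsDecreasing (x ∷ y ∷ xs)  = AdjDecr x y × RunsDecreasing (y ∷ xs)

alphabet : ℕ → ℕ → List Sym
alphabet n k = map (λ i → red (suc i)) (upTo n) ++ map (λ j → blue (suc j)) (upTo k)

InC : ℕ → ℕ → List Sym → List Sym → Set
InC n k S₁ S₂ =
  ((S₁ ++ S₂) ↭ alphabet n k) ×
  StartsWith b S₁ × StartsWith r S₂ ×
  RunsDecreasing S₁ × RunsDecreasing S₂

-- The set E_n^k (0-indexed: column i+1 and value π(i)+1)

InE : (n k : ℕ) → Permutation′ (suc (n + k)) → Set
InE n k π = ∀ (i : Fin (suc (n + k))) → (toℕ i < toℕ (π ⟨$⟩ʳ i)) ⇔ (toℕ i < n)

-- Labels of columns / rows (0-indexed Fin positions:
-- columns from the left, rows from the bottom)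

-- columns 1..n+k+1 labeled n^r,...,1^r,k^b,...,1^b,0^b
colLabel : (n k : ℕ) → Fin (suc (n + k)) → Sym
colLabel n k i = if suc (toℕ i) ≤ᵇ n then red (n ∸ toℕ i) else blue ((n + k) ∸ toℕ i)

-- rows from top to bottom labeled 1^b,...,k^b,0^r,1^r,...,n^r;
-- row value 1 (index 0) is n^r, row value n+k+1 (index n+k) is 1^b
rowLabel : (n k : ℕ) → Fin (suc (n + k)) → Sym
rowLabel n k j = if toℕ j ≤ᵇ n then red (n ∸ toℕ j) else blue (suc (n + k) ∸ toℕ j)

rowsTopToBottom : ℕ → ℕ → List Sym
rowsTopToBottom n k = map (λ j → blue (suc j)) (upTo k) ++ map red (upTo (suc n))

-- Rook placements: lists of rooks (column label , row label)

Rook : Set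
Rook = Sym × Sym

graph : (n k : ℕ) → Permutation′ (suc (n + k)) → List Rook
graph n k π = map (λ i → colLabel n k i , rowLabel n k (π ⟨$⟩ʳ i)) (allFin (suc (n + k)))

colOccupied : Sym → List Rook → Bool
colOccupied x P = any (λ { (c , _) → c ==S x }) P

rowOccupied : Sym → List Rook → Bool
rowOccupied y P = any (λ { (_ , w) → w ==S y }) P

pairRook : Sym → Sym → List Rook
pairRook (red x)  (red y)  = (red x , red y) ∷ []
pairRook (blue x) (blue y) = (blue y , blue x) ∷ []
pairRook _        _        = []

step1 : List Sym → List Rook
step1 []           = []
step1 (x ∷ [])     = []
step1 (x ∷ y ∷ xs) = pairRook x y ++ step1 (y ∷ xs)

topFreeRow : Color → List Sym → List Rook → Maybe Sym
topFreeRow c []       P = nothing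
topFreeRow c (w ∷ ws) P =
  if not (color w ==C c) ∧ not (rowOccupied w P) then just w else topFreeRow c ws P

step2 : List Sym → List Sym → List Rook → Maybe (List Rook)
step2 rows []       P = just P
step2 rows (x ∷ xs) P with colOccupied x P
... | true  = step2 rows xs P
... | false with topFreeRow (color x) rows P
...   | nothing = nothing
...   | just w  = step2 rows xs ((x , w) ∷ P)

-- S = S₁ 0^b S₂ 0^r ; x_1 ... x_{n+k+1} = S₁ 0^b S₂ (all letters but the last)
procedure : (n k : ℕ) → List Sym → List Sym → Maybe (List Rook)
procedure n k S₁ S₂ =
  step2 (rowsTopToBottom n k) (S₁ ++ blue 0 ∷ S₂)
        (step1 (S₁ ++ blue 0 ∷ S₂ ++ red 0 ∷ []))

Produces : (n k : ℕ) → List Sym → List Sym → Permutation′ (suc (n + k)) → Set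
Produces n k S₁ S₂ π = Σ (List Rook) λ P → procedure n k S₁ S₂ ≡ just P × P ↭ graph n k π

-- Read S₁ 0ᵇ S₂ 0ʳ as a sequence of blocks, each a maximal blue run followed by a
-- maximal red run, the last red run ending in 0ʳ.  A blue run t > b₁ > … and a reversed
-- red run l < r₁ < … are chains, and for consecutive letters x, y of a chain step (1)
-- puts the rook of column y into row x; since the runs decrease, these rooks satisfy the
-- excedance condition of Eᵏₙ.  After step (1) the free rows are the last letters of the
-- chains, so step (2) gives the column of every chain head a free row of the other
-- colour, and such rooks satisfy the condition trivially.  Hence the procedure yields a
-- permutation in Eᵏₙ.
--
-- Conversely, for π ∈ Eᵏₙ the chains are recovered by starting at the columns whose rook
-- lies in a row of the other colour (the heads) and going from row to column along the
-- rooks while the colour stays the same; the excedance condition makes this terminate.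
-- The blue heads, ordered by their rows, start the blocks and the red heads, ordered
-- likewise, end their red runs.  This determines the blocks, so the pair (S₁, S₂) with
-- image π exists and is unique.
module Submission where

open import Defs
open import Data.Bool using (Bool; true; false; if_then_else_; _∧_; _∨_; not)
open import Data.Bool.Properties using (T-≡; ∧-identityʳ)
open import Data.Empty using (⊥; ⊥-elim)
open import Data.Fin using (Fin; toℕ) renaming (zero to fzero; suc to fsuc)
open import Data.Fin.Permutation using (Permutation′; _⟨$⟩ʳ_; _⟨$⟩ˡ_; permutation; inverseˡ; inverseʳ)
open import Data.Fin.Properties using (toℕ≤pred[n])
open import Data.List using (List; []; _∷_; _++_; _∷ʳ_; map; reverse; concatMap; length; upTo; filterᵇ)
open import Data.List.Properties
  using (++-assoc; ++-identityʳ; map-++; unfold-reverse; reverse-involutive; reverse-++;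
         length-map; length-++; ∷-injective; ∷ʳ-injectiveˡ; ++-conicalʳ)
open import Data.List.Membership.Propositional using (_∈_; _∉_)
open import Data.List.Membership.Propositional.Properties
  using (∈-++⁺ˡ; ∈-++⁺ʳ; ∈-++⁻; ∈-map⁺; ∈-map⁻; ∈-allFin; ∈-upTo⁺; ∈-upTo⁻; ∈-∃++; ∈-filter⁺; ∈-filter⁻)
open import Data.List.Membership.Propositional.Properties.WithK using (unique∧set⇒bag)
open import Data.List.Relation.Binary.BagAndSetEquality using (∼bag⇒↭)
open import Data.List.Relation.Binary.Permutation.Propositional
  using (_↭_; ↭-refl; ↭-trans; ↭-sym; ↭-reflexive; prep; swap; ↭⇒↭ₛ; module PermutationReasoning)
open import Data.List.Relation.Binary.Permutation.Propositional.Properties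
  using (++⁺; ++⁺ˡ; ++⁺ʳ; ++-comm; shift; shifts; ↭-reverse; ↭-length; map⁺; All-resp-↭; ∈-resp-↭)
open import Data.List.Relation.Binary.Permutation.Setoid.Properties using (Unique-resp-↭)
open import Data.List.Relation.Unary.All using (All; []; _∷_; lookup; tabulate)
open import Data.List.Relation.Unary.All.Properties using (All¬⇒¬Any; ¬Any⇒All¬)
open import Data.List.Relation.Unary.Any using (here; there; any?)
open import Data.List.Relation.Unary.Unique.Propositional using (Unique)
open import Data.List.Relation.Unary.Unique.Propositional.Properties as Unique
  using (Unique[x∷xs]⇒x∉xs)
open import Data.List.Relation.Unary.AllPairs using ([]; _∷_)
open import Data.Maybe using (just)
open import Data.Maybe.Properties using (just-injective)
open import Data.Nat using (ℕ; zero; suc; pred; _+_; _∸_; _<_; _≤_; _≤ᵇ_; _≤?_; z≤n; s≤s; s≤s⁻¹)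
open import Data.Nat.Properties
open import Data.Product using (Σ; _×_; _,_; proj₁; proj₂)
open import Data.Sum using (_⊎_; inj₁; inj₂; [_,_]′)
open import Data.Unit using (⊤; tt)
open import Function using (_∘_)
open import Function.Bundles using (_⇔_; mk⇔; Equivalence)
open import Relation.Binary.Definitions using (DecidableEquality)
open import Relation.Binary.PropositionalEquality
  using (_≡_; _≢_; refl; sym; trans; cong; cong₂; subst; setoid; module ≡-Reasoning)
open import Relation.Nullary using (¬_; Dec; yes; no)
open import Relation.Nullary.Decidable using (_×-dec_; T?)

red-injective : ∀ {x y} → red x ≡ red y → x ≡ y
red-injective refl = refl

blue-injective : ∀ {x y} → blue x ≡ blue y → x ≡ y
blue-injective refl = refl

_≟S_ : DecidableEquality Sym
red x ≟S red y with x ≟ y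
... | yes refl = yes refl
... | no x≢y = no (x≢y ∘ red-injective)
blue x ≟S blue y with x ≟ y
... | yes refl = yes refl
... | no x≢y = no (x≢y ∘ blue-injective)
red x ≟S blue y = no (λ ())
blue x ≟S red y = no (λ ())

_≟C_ : DecidableEquality Color
r ≟C r = yes refl
b ≟C b = yes refl
r ≟C b = no (λ ())
b ≟C r = no (λ ())

b≢r : b ≢ r
b≢r ()

r≢b : r ≢ b
r≢b ()

color≡b⊎r : ∀ z → color z ≡ b ⊎ color z ≡ r
color≡b⊎r (red _) = inj₂ refl
color≡b⊎r (blue _) = inj₁ refl

other : Color → Color
other r = b
other b = r

other≢ : ∀ c → other c ≢ c
other≢ r ()
other≢ b ()

≢∧≢⇒≡ : ∀ {x y z : Color} → x ≢ y → y ≢ z → x ≡ z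
≢∧≢⇒≡ {r} {r} x≢y _ = ⊥-elim (x≢y refl)
≢∧≢⇒≡ {b} {b} x≢y _ = ⊥-elim (x≢y refl)
≢∧≢⇒≡ {r} {b} {r} _ _ = refl
≢∧≢⇒≡ {r} {b} {b} _ y≢z = ⊥-elim (y≢z refl)
≢∧≢⇒≡ {b} {r} {r} _ y≢z = ⊥-elim (y≢z refl)
≢∧≢⇒≡ {b} {r} {b} _ _ = refl

∧≡true⇒ : ∀ {x y} → (x ∧ y) ≡ true → x ≡ true × y ≡ true
∧≡true⇒ {true} e = refl , e

not≡true⇒ : ∀ {x} → not x ≡ true → x ≡ false
not≡true⇒ {false} _ = refl

==C-refl : ∀ c → (c ==C c) ≡ true
==C-refl r = refl
==C-refl b = refl

==C⇒≡ : ∀ c c' → (c ==C c') ≡ true → c ≡ c'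
==C⇒≡ r r _ = refl
==C⇒≡ b b _ = refl

==C-false⇒other : ∀ c c' → (c ==C c') ≡ false → c ≡ other c'
==C-false⇒other r b _ = refl
==C-false⇒other b r _ = refl

==C-false⇒≢ : ∀ c c' → (c ==C c') ≡ false → c ≢ c'
==C-false⇒≢ r r () refl
==C-false⇒≢ b b () refl

≢⇒==C-false : ∀ c c' → c ≢ c' → (c ==C c') ≡ false
≢⇒==C-false r r c≢c' = ⊥-elim (c≢c' refl)
≢⇒==C-false r b _ = refl
≢⇒==C-false b r _ = refl
≢⇒==C-false b b c≢c' = ⊥-elim (c≢c' refl)

==S⇒≡ : ∀ x y → (x ==S y) ≡ true → x ≡ y
==S⇒≡ (red x) (red y) e = cong red (≡ᵇ⇒≡ x y (Equivalence.from T-≡ e))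
==S⇒≡ (blue x) (blue y) e = cong blue (≡ᵇ⇒≡ x y (Equivalence.from T-≡ e))

==S-refl : ∀ x → (x ==S x) ≡ true
==S-refl (red x) = Equivalence.to T-≡ (≡⇒≡ᵇ x x refl)
==S-refl (blue x) = Equivalence.to T-≡ (≡⇒≡ᵇ x x refl)

≢⇒==S-false : ∀ x y → x ≢ y → (x ==S y) ≡ false
≢⇒==S-false x y x≢y with x ==S y in eq
... | true = ⊥-elim (x≢y (==S⇒≡ x y eq))
... | false = refl

colOccupied⇒∈ : ∀ x P → colOccupied x P ≡ true → x ∈ map proj₁ P
colOccupied⇒∈ x ((c , w) ∷ P) e with c ==S x in eq
... | true = here (sym (==S⇒≡ c x eq))
... | false = there (colOccupied⇒∈ x P e)

∈⇒colOccupied : ∀ x P → x ∈ map proj₁ P → colOccupied x P ≡ true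
∈⇒colOccupied x ((c , w) ∷ P) (here refl) rewrite ==S-refl x = refl
∈⇒colOccupied x ((c , w) ∷ P) (there m) with c ==S x
... | true = refl
... | false = ∈⇒colOccupied x P m

∉⇒colOccupied-false : ∀ x P → x ∉ map proj₁ P → colOccupied x P ≡ false
∉⇒colOccupied-false x P x∉ with colOccupied x P in eq
... | true = ⊥-elim (x∉ (colOccupied⇒∈ x P eq))
... | false = refl

rowOccupied⇒∈ : ∀ x P → rowOccupied x P ≡ true → x ∈ map proj₂ P
rowOccupied⇒∈ x ((c , w) ∷ P) e with w ==S x in eq
... | true = here (sym (==S⇒≡ w x eq))
... | false = there (rowOccupied⇒∈ x P e)

∈⇒rowOccupied : ∀ x P → x ∈ map proj₂ P → rowOccupied x P ≡ true
∈⇒rowOccupied x ((c , w) ∷ P) (here refl) rewrite ==S-refl x = refl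
∈⇒rowOccupied x ((c , w) ∷ P) (there m) with w ==S x
... | true = refl
... | false = ∈⇒rowOccupied x P m

∉⇒rowOccupied-false : ∀ x P → x ∉ map proj₂ P → rowOccupied x P ≡ false
∉⇒rowOccupied-false x P x∉ with rowOccupied x P in eq
... | true = ⊥-elim (x∉ (rowOccupied⇒∈ x P eq))
... | false = refl

colOccupied-mono : ∀ z q P → colOccupied z P ≡ true → colOccupied z (q ∷ P) ≡ true
colOccupied-mono z (c , w) P e with c ==S z
... | true = refl
... | false = e

colOccupied-cons-other : ∀ z x a P → x ≢ z → colOccupied z ((x , a) ∷ P) ≡ colOccupied z P
colOccupied-cons-other z x a P x≢z rewrite ≢⇒==S-false x z x≢z = refl

module _ {A : Set} where

  Unique-cons : ∀ {x : A} {xs} → x ∉ xs → Unique xs → Unique (x ∷ xs)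
  Unique-cons x∉xs u = ¬Any⇒All¬ _ x∉xs ∷ u

  Unique-tail : ∀ {x : A} {xs} → Unique (x ∷ xs) → Unique xs
  Unique-tail (_ ∷ u) = u

  Unique-↭ : ∀ {xs ys : List A} → xs ↭ ys → Unique xs → Unique ys
  Unique-↭ p = Unique-resp-↭ (setoid A) (↭⇒↭ₛ p)

  Unique-++ : ∀ {xs ys : List A} → Unique xs → Unique ys → (∀ {z} → z ∈ xs → z ∈ ys → ⊥) →
              Unique (xs ++ ys)
  Unique-++ ux uy disjoint = Unique.++⁺ ux uy (λ (m , m') → disjoint m m')

  Unique-++ˡ : ∀ (xs : List A) {ys} → Unique (xs ++ ys) → Unique xs
  Unique-++ˡ [] _ = []
  Unique-++ˡ (x ∷ xs) (x∉ ∷ u) = ¬Any⇒All¬ xs (All¬⇒¬Any x∉ ∘ ∈-++⁺ˡ) ∷ Unique-++ˡ xs u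

  Unique-++ʳ : ∀ (xs : List A) {ys} → Unique (xs ++ ys) → Unique ys
  Unique-++ʳ [] u = u
  Unique-++ʳ (x ∷ xs) (_ ∷ u) = Unique-++ʳ xs u

  Unique-++-disjoint : ∀ (xs : List A) {ys} → Unique (xs ++ ys) → ∀ {z} → z ∈ xs → z ∈ ys → ⊥
  Unique-++-disjoint (x ∷ xs) (x∉ ∷ u) (here refl) m' = All¬⇒¬Any x∉ (∈-++⁺ʳ xs m')
  Unique-++-disjoint (x ∷ xs) (_ ∷ u) (there m) m' = Unique-++-disjoint xs u m m'

  Unique⇒↭ : ∀ {xs ys : List A} → Unique xs → Unique ys →
             (∀ {z} → z ∈ xs → z ∈ ys) → (∀ {z} → z ∈ ys → z ∈ xs) → xs ↭ ys
  Unique⇒↭ ux uy to from = ∼bag⇒↭ (unique∧set⇒bag ux uy (mk⇔ to from))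

  ∈-↭ : ∀ {xs ys : List A} {z} → xs ↭ ys → z ∈ xs → z ∈ ys
  ∈-↭ p m = ∈-resp-↭ p m

module _ {A B : Set} where

  Unique-map-injectiveOn : ∀ (f : A → B) xs → Unique xs →
    (∀ {x y} → x ∈ xs → y ∈ xs → f x ≡ f y → x ≡ y) → Unique (map f xs)
  Unique-map-injectiveOn f [] _ _ = []
  Unique-map-injectiveOn f (x ∷ xs) u inj =
    Unique-cons fx∉ (Unique-map-injectiveOn f xs (Unique-tail u) (λ m m' → inj (there m) (there m')))
    where
    fx∉ : f x ∉ map f xs
    fx∉ m with ∈-map⁻ f m
    ... | y , y∈ , fx≡fy = Unique[x∷xs]⇒x∉xs u (subst (_∈ xs) (sym (inj (here refl) (there y∈) fx≡fy)) y∈)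

≤⇒≤ᵇ≡true : ∀ {m n} → m ≤ n → (m ≤ᵇ n) ≡ true
≤⇒≤ᵇ≡true le = Equivalence.to T-≡ (≤⇒≤ᵇ le)

≤ᵇ≡true⇒≤ : ∀ m n → (m ≤ᵇ n) ≡ true → m ≤ n
≤ᵇ≡true⇒≤ m n e = ≤ᵇ⇒≤ m n (Equivalence.from T-≡ e)

≤ᵇ≡false⇒> : ∀ m n → (m ≤ᵇ n) ≡ false → n < m
≤ᵇ≡false⇒> m n e = ≰⇒> λ m≤n → case (trans (sym e) (≤⇒≤ᵇ≡true m≤n))
  where
  case : false ≡ true → ⊥
  case ()

>⇒≤ᵇ≡false : ∀ m n → n < m → (m ≤ᵇ n) ≡ false
>⇒≤ᵇ≡false m n n<m with m ≤ᵇ n in eq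
... | true = ⊥-elim (<⇒≱ n<m (≤ᵇ≡true⇒≤ m n eq))
... | false = refl

-- The index x in Fin (suc m), clamped to m for larger x.
clampFin : ∀ {m} → ℕ → Fin (suc m)
clampFin zero = fzero
clampFin {zero} (suc x) = fzero
clampFin {suc m} (suc x) = fsuc (clampFin {m} x)

toℕ-clampFin : ∀ {m} x → x ≤ m → toℕ (clampFin {m} x) ≡ x
toℕ-clampFin zero _ = refl
toℕ-clampFin {suc m} (suc x) (s≤s le) = cong suc (toℕ-clampFin x le)

clampFin-toℕ : ∀ {m} (i : Fin (suc m)) → clampFin {m} (toℕ i) ≡ i
clampFin-toℕ fzero = refl
clampFin-toℕ {suc m} (fsuc i) = cong fsuc (clampFin-toℕ i)

IsColumnLabel : ℕ → ℕ → Sym → Set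
IsColumnLabel n k (red x) = 1 ≤ x × x ≤ n
IsColumnLabel n k (blue j) = j ≤ k

IsRowLabel : ℕ → ℕ → Sym → Set
IsRowLabel n k (red x) = x ≤ n
IsRowLabel n k (blue y) = 1 ≤ y × y ≤ k

IsLetter : ℕ → ℕ → Sym → Set
IsLetter n k (red x) = x ≤ n
IsLetter n k (blue j) = j ≤ k

isColumnLabel? : ∀ n k c → Dec (IsColumnLabel n k c)
isColumnLabel? n k (red x) = (1 ≤? x) ×-dec (x ≤? n)
isColumnLabel? n k (blue y) = y ≤? k

column⇒letter : ∀ {n k} c → IsColumnLabel n k c → IsLetter n k c
column⇒letter (red x) (_ , x≤n) = x≤n
column⇒letter (blue x) x≤k = x≤k

row⇒letter : ∀ {n k} w → IsRowLabel n k w → IsLetter n k w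
row⇒letter (red x) x≤n = x≤n
row⇒letter (blue x) (_ , x≤k) = x≤k

letter⇒column : ∀ {n k} c → IsLetter n k c → c ≢ red 0 → IsColumnLabel n k c
letter⇒column (red zero) _ c≢0 = ⊥-elim (c≢0 refl)
letter⇒column (red (suc x)) x<n _ = s≤s z≤n , x<n
letter⇒column (blue x) x≤k _ = x≤k

letter⇒row : ∀ {n k} w → IsLetter n k w → w ≢ blue 0 → IsRowLabel n k w
letter⇒row (red x) x≤n _ = x≤n
letter⇒row (blue zero) _ w≢0 = ⊥-elim (w≢0 refl)
letter⇒row (blue (suc x)) x<k _ = s≤s z≤n , x<k

¬row-blue0 : ∀ {n k} → ¬ IsRowLabel n k (blue 0)
¬row-blue0 (() , _)

¬column-red0 : ∀ {n k} → ¬ IsColumnLabel n k (red 0)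
¬column-red0 (() , _)

colIndex : (n k : ℕ) → Sym → Fin (suc (n + k))
colIndex n k (red x) = clampFin (n ∸ x)
colIndex n k (blue j) = clampFin (n + k ∸ j)

rowIndex : (n k : ℕ) → Sym → Fin (suc (n + k))
rowIndex n k (red x) = clampFin (n ∸ x)
rowIndex n k (blue y) = clampFin (suc (n + k) ∸ y)

module _ (n k : ℕ) where

  private
    bound : (i : Fin (suc (n + k))) → toℕ i ≤ n + k
    bound i = toℕ≤pred[n] i

  colIndex-colLabel : ∀ i → colIndex n k (colLabel n k i) ≡ i
  colIndex-colLabel i with suc (toℕ i) ≤ᵇ n in eq
  ... | true rewrite m∸[m∸n]≡n (<⇒≤ (≤ᵇ≡true⇒≤ (suc (toℕ i)) n eq)) = clampFin-toℕ i
  ... | false rewrite m∸[m∸n]≡n (bound i) = clampFin-toℕ i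

  colLabel-isColumnLabel : ∀ i → IsColumnLabel n k (colLabel n k i)
  colLabel-isColumnLabel i with suc (toℕ i) ≤ᵇ n in eq
  ... | true = m<n⇒0<n∸m (≤ᵇ≡true⇒≤ (suc (toℕ i)) n eq) , m∸n≤m n (toℕ i)
  ... | false = ≤-trans (∸-monoʳ-≤ (n + k) (s≤s⁻¹ (≤ᵇ≡false⇒> (suc (toℕ i)) n eq))) (≤-reflexive (m+n∸m≡n n k))

  colLabel-colIndex : ∀ c → IsColumnLabel n k c → colLabel n k (colIndex n k c) ≡ c
  colLabel-colIndex (red x) (1≤x , x≤n)
    rewrite toℕ-clampFin {n + k} (n ∸ x) (≤-trans (m∸n≤m n x) (m≤m+n n k))
          | ≤⇒≤ᵇ≡true (∸-monoʳ-< 1≤x x≤n)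
          | m∸[m∸n]≡n x≤n = refl
  colLabel-colIndex (blue j) j≤k
    rewrite toℕ-clampFin {n + k} (n + k ∸ j) (m∸n≤m (n + k) j)
          | >⇒≤ᵇ≡false (suc (n + k ∸ j)) n (s≤s (≤-trans (≤-reflexive (sym (m+n∸n≡m n j)))
                (∸-monoˡ-≤ j (+-monoʳ-≤ n j≤k))))
          | m∸[m∸n]≡n (≤-trans j≤k (m≤n+m k n)) = refl

  rowIndex-rowLabel : ∀ i → rowIndex n k (rowLabel n k i) ≡ i
  rowIndex-rowLabel i with toℕ i ≤ᵇ n in eq
  ... | true rewrite m∸[m∸n]≡n (≤ᵇ≡true⇒≤ (toℕ i) n eq) = clampFin-toℕ i
  ... | false rewrite m∸[m∸n]≡n (≤-trans (bound i) (n≤1+n (n + k))) = clampFin-toℕ i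

  rowLabel-isRowLabel : ∀ i → IsRowLabel n k (rowLabel n k i)
  rowLabel-isRowLabel i with toℕ i ≤ᵇ n in eq
  ... | true = m∸n≤m n (toℕ i)
  ... | false = m<n⇒0<n∸m (s≤s (bound i)) ,
      ≤-trans (∸-monoʳ-≤ (suc (n + k)) (≤ᵇ≡false⇒> (toℕ i) n eq)) (≤-reflexive (m+n∸m≡n n k))

  rowLabel-rowIndex : ∀ w → IsRowLabel n k w → rowLabel n k (rowIndex n k w) ≡ w
  rowLabel-rowIndex (red x) x≤n
    rewrite toℕ-clampFin {n + k} (n ∸ x) (≤-trans (m∸n≤m n x) (m≤m+n n k))
          | ≤⇒≤ᵇ≡true (m∸n≤m n x)
          | m∸[m∸n]≡n x≤n = refl
  rowLabel-rowIndex (blue y) (1≤y , y≤k)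
    rewrite toℕ-clampFin {n + k} (suc (n + k) ∸ y) (∸-monoʳ-≤ (suc (n + k)) 1≤y)
          | >⇒≤ᵇ≡false (suc (n + k) ∸ y) n (≤-trans (s≤s (≤-trans (≤-reflexive (sym (m+n∸n≡m n y)))
                (∸-monoˡ-≤ y (+-monoʳ-≤ n y≤k)))) (≤-reflexive (sym (+-∸-assoc 1 (≤-trans y≤k (m≤n+m k n))))))
          | m∸[m∸n]≡n (≤-trans y≤k (≤-trans (m≤n+m k n) (n≤1+n (n + k)))) = refl

-- The condition of Eᵏₙ, for a rook in column c and row w, in terms of labels.
Admissible : Sym → Sym → Set
Admissible (red x) (red y) = y < x
Admissible (blue j) (blue y) = j < y
Admissible _ _ = ⊤

admissible-colors≢ : ∀ c w → color c ≢ color w → Admissible c w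
admissible-colors≢ (red x) (red y) c≢w = ⊥-elim (c≢w refl)
admissible-colors≢ (red x) (blue y) _ = tt
admissible-colors≢ (blue x) (red y) _ = tt
admissible-colors≢ (blue x) (blue y) c≢w = ⊥-elim (c≢w refl)

module _ (n k : ℕ) where

  private
    bound : (i : Fin (suc (n + k))) → toℕ i ≤ n + k
    bound i = toℕ≤pred[n] i

  admissible⇒excedance⇔ : ∀ i j → Admissible (colLabel n k i) (rowLabel n k j) → (toℕ i < toℕ j ⇔ toℕ i < n)
  admissible⇒excedance⇔ i j adm with suc (toℕ i) ≤ᵇ n in e₁ | toℕ j ≤ᵇ n in e₂
  ... | true | true = mk⇔ (λ _ → i<n) (λ _ → ∸-cancelʳ-< adm)
    where i<n = ≤ᵇ≡true⇒≤ (suc (toℕ i)) n e₁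
  ... | true | false = mk⇔ (λ _ → i<n) (λ _ → <-trans i<n (≤ᵇ≡false⇒> (toℕ j) n e₂))
    where i<n = ≤ᵇ≡true⇒≤ (suc (toℕ i)) n e₁
  ... | false | true = mk⇔ (λ i<j → ⊥-elim (<⇒≱ (<-≤-trans i<j (≤ᵇ≡true⇒≤ (toℕ j) n e₂)) n≤i))
                           (λ i<n → ⊥-elim (<⇒≱ i<n n≤i))
    where n≤i = s≤s⁻¹ (≤ᵇ≡false⇒> (suc (toℕ i)) n e₁)
  ... | false | false = mk⇔ (λ i<j → ⊥-elim (<-irrefl refl (<-≤-trans adm (∸-monoʳ-≤ (suc (n + k)) i<j))))
                            (λ i<n → ⊥-elim (<⇒≱ i<n n≤i))
    where n≤i = s≤s⁻¹ (≤ᵇ≡false⇒> (suc (toℕ i)) n e₁)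

  excedance⇔⇒admissible : ∀ i j → (toℕ i < toℕ j ⇔ toℕ i < n) → Admissible (colLabel n k i) (rowLabel n k j)
  excedance⇔⇒admissible i j i<j⇔i<n with suc (toℕ i) ≤ᵇ n in e₁ | toℕ j ≤ᵇ n in e₂
  ... | true | true = ∸-monoʳ-< (Equivalence.from i<j⇔i<n (≤ᵇ≡true⇒≤ (suc (toℕ i)) n e₁)) (≤ᵇ≡true⇒≤ (toℕ j) n e₂)
  ... | true | false = tt
  ... | false | true = tt
  ... | false | false = ≤-trans (s≤s (∸-monoʳ-≤ (n + k) j≤i)) (≤-reflexive (sym (+-∸-assoc 1 (bound j))))
    where
    n≤i = s≤s⁻¹ (≤ᵇ≡false⇒> (suc (toℕ i)) n e₁)
    j≤i : toℕ j ≤ toℕ i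
    j≤i = ≮⇒≥ (λ i<j → <⇒≱ (Equivalence.to i<j⇔i<n i<j) n≤i)

  module OnLabels (π : Permutation′ (suc (n + k))) where

    rowOfπ : Sym → Sym
    rowOfπ c = rowLabel n k (π ⟨$⟩ʳ colIndex n k c)

    colOfπ : Sym → Sym
    colOfπ w = colLabel n k (π ⟨$⟩ˡ rowIndex n k w)

    ∈graph⇒ : ∀ {c w} → (c , w) ∈ graph n k π → IsColumnLabel n k c × rowOfπ c ≡ w
    ∈graph⇒ m with ∈-map⁻ (λ i → colLabel n k i , rowLabel n k (π ⟨$⟩ʳ i)) m
    ... | i , _ , refl rewrite colIndex-colLabel n k i = colLabel-isColumnLabel n k i , refl

    ∈graph⇐ : ∀ {c} → IsColumnLabel n k c → (c , rowOfπ c) ∈ graph n k π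
    ∈graph⇐ {c} ok with ∈-map⁺ (λ i → colLabel n k i , rowLabel n k (π ⟨$⟩ʳ i)) (∈-allFin (colIndex n k c))
    ... | m rewrite colLabel-colIndex n k c ok = m

    colOfπ-rowOfπ : ∀ {c} → IsColumnLabel n k c → colOfπ (rowOfπ c) ≡ c
    colOfπ-rowOfπ {c} ok
      rewrite rowIndex-rowLabel n k (π ⟨$⟩ʳ colIndex n k c) | inverseˡ π {colIndex n k c} = colLabel-colIndex n k c ok

    rowOfπ-colOfπ : ∀ {w} → IsRowLabel n k w → rowOfπ (colOfπ w) ≡ w
    rowOfπ-colOfπ {w} ok
      rewrite colIndex-colLabel n k (π ⟨$⟩ˡ rowIndex n k w) | inverseʳ π {rowIndex n k w} = rowLabel-rowIndex n k w ok

    admissible : InE n k π → ∀ {c} → IsColumnLabel n k c → Admissible c (rowOfπ c)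
    admissible π∈E {c} ok = subst (λ z → Admissible z (rowOfπ c)) (colLabel-colIndex n k c ok)
      (excedance⇔⇒admissible (colIndex n k c) (π ⟨$⟩ʳ colIndex n k c) (π∈E (colIndex n k c)))

    Unique-graph : Unique (graph n k π)
    Unique-graph = Unique.map⁺ injective (Unique.allFin⁺ _)
      where
      injective : ∀ {i j} → (colLabel n k i , rowLabel n k (π ⟨$⟩ʳ i)) ≡ (colLabel n k j , rowLabel n k (π ⟨$⟩ʳ j)) → i ≡ j
      injective {i} {j} e = trans (sym (colIndex-colLabel n k i))
                                  (trans (cong (colIndex n k ∘ proj₁) e) (colIndex-colLabel n k j))

    ↭graph : (Q : List Rook) → Unique (map proj₁ Q) → (∀ {c} → IsColumnLabel n k c → c ∈ map proj₁ Q) →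
             (∀ {q} → q ∈ Q → q ∈ graph n k π) → Q ↭ graph n k π
    ↭graph Q uniqueCols allCols Q⊆graph = Unique⇒↭ (Unique.map⁻ uniqueCols) Unique-graph Q⊆graph graph⊆Q
      where
      graph⊆Q : ∀ {q} → q ∈ graph n k π → q ∈ Q
      graph⊆Q {c , w} m with ∈graph⇒ m
      ... | ok , refl with ∈-map⁻ proj₁ (allCols ok)
      ... | (c' , w') , m' , refl with ∈graph⇒ (Q⊆graph m')
      ... | _ , refl = m'

  lookupRow : Sym → List Rook → Sym
  lookupRow c [] = red 0
  lookupRow c ((c' , w) ∷ Q) = if c' ==S c then w else lookupRow c Q

  lookupCol : Sym → List Rook → Sym
  lookupCol w [] = red 0
  lookupCol w ((c , w') ∷ Q) = if w' ==S w then c else lookupCol w Q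

  lookupRow-∈ : ∀ c Q → c ∈ map proj₁ Q → (c , lookupRow c Q) ∈ Q
  lookupRow-∈ c ((c' , w) ∷ Q) m with c' ==S c in eq
  ... | true rewrite ==S⇒≡ c' c eq = here refl
  lookupRow-∈ c ((c' , w) ∷ Q) (here refl) | false rewrite ==S-refl c' with eq
  ... | ()
  lookupRow-∈ c ((c' , w) ∷ Q) (there m) | false = there (lookupRow-∈ c Q m)

  lookupRow-unique : ∀ {c w} Q → Unique (map proj₁ Q) → (c , w) ∈ Q → lookupRow c Q ≡ w
  lookupRow-unique {c} ((c' , w') ∷ Q) _ (here refl) rewrite ==S-refl c = refl
  lookupRow-unique {c} ((c' , w') ∷ Q) (c'∉ ∷ u) (there m) with c' ==S c in eq
  ... | true = ⊥-elim (All¬⇒¬Any c'∉ (subst (_∈ map proj₁ Q) (sym (==S⇒≡ c' c eq)) (∈-map⁺ proj₁ m)))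
  ... | false = lookupRow-unique Q u m

  lookupCol-∈ : ∀ w Q → w ∈ map proj₂ Q → (lookupCol w Q , w) ∈ Q
  lookupCol-∈ w ((c , w') ∷ Q) m with w' ==S w in eq
  ... | true rewrite ==S⇒≡ w' w eq = here refl
  lookupCol-∈ w ((c , w') ∷ Q) (here refl) | false rewrite ==S-refl w' with eq
  ... | ()
  lookupCol-∈ w ((c , w') ∷ Q) (there m) | false = there (lookupCol-∈ w Q m)

  lookupCol-unique : ∀ {c w} Q → Unique (map proj₂ Q) → (c , w) ∈ Q → lookupCol w Q ≡ c
  lookupCol-unique {w = w} ((c' , w') ∷ Q) _ (here refl) rewrite ==S-refl w = refl
  lookupCol-unique {w = w} ((c' , w') ∷ Q) (w'∉ ∷ u) (there m) with w' ==S w in eq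
  ... | true = ⊥-elim (All¬⇒¬Any w'∉ (subst (_∈ map proj₂ Q) (sym (==S⇒≡ w' w eq)) (∈-map⁺ proj₂ m)))
  ... | false = lookupCol-unique Q u m

  record IsFullPlacement (Q : List Rook) : Set where
    field
      uniqueCols : Unique (map proj₁ Q)
      uniqueRows : Unique (map proj₂ Q)
      cols⇒ : ∀ {c} → c ∈ map proj₁ Q → IsColumnLabel n k c
      cols⇐ : ∀ {c} → IsColumnLabel n k c → c ∈ map proj₁ Q
      rows⇒ : ∀ {w} → w ∈ map proj₂ Q → IsRowLabel n k w
      rows⇐ : ∀ {w} → IsRowLabel n k w → w ∈ map proj₂ Q
      admissibleRooks : ∀ {c w} → (c , w) ∈ Q → Admissible c w

  fullPlacement⇒permutation : (Q : List Rook) → IsFullPlacement Q →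
    Σ (Permutation′ (suc (n + k))) λ π → InE n k π × Q ↭ graph n k π
  fullPlacement⇒permutation Q full = π , π∈E , OnLabels.↭graph π Q uniqueCols cols⇐ Q⊆graph
    where
    open IsFullPlacement full
    open ≡-Reasoning
    f f⁻¹ : Fin (suc (n + k)) → Fin (suc (n + k))
    f i = rowIndex n k (lookupRow (colLabel n k i) Q)
    f⁻¹ j = colIndex n k (lookupCol (rowLabel n k j) Q)

    rookInColumn : ∀ i → (colLabel n k i , lookupRow (colLabel n k i) Q) ∈ Q
    rookInColumn i = lookupRow-∈ (colLabel n k i) Q (cols⇐ (colLabel-isColumnLabel n k i))

    rookInRow : ∀ j → (lookupCol (rowLabel n k j) Q , rowLabel n k j) ∈ Q
    rookInRow j = lookupCol-∈ (rowLabel n k j) Q (rows⇐ (rowLabel-isRowLabel n k j))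

    f∘f⁻¹ : ∀ j → f (f⁻¹ j) ≡ j
    f∘f⁻¹ j = begin
        rowIndex n k (lookupRow (colLabel n k (colIndex n k c)) Q)
          ≡⟨ cong (λ z → rowIndex n k (lookupRow z Q)) (colLabel-colIndex n k c (cols⇒ (∈-map⁺ proj₁ (rookInRow j)))) ⟩
        rowIndex n k (lookupRow c Q) ≡⟨ cong (rowIndex n k) (lookupRow-unique Q uniqueCols (rookInRow j)) ⟩
        rowIndex n k (rowLabel n k j) ≡⟨ rowIndex-rowLabel n k j ⟩
        j ∎
      where c = lookupCol (rowLabel n k j) Q

    f⁻¹∘f : ∀ i → f⁻¹ (f i) ≡ i
    f⁻¹∘f i = begin
        colIndex n k (lookupCol (rowLabel n k (rowIndex n k w)) Q)
          ≡⟨ cong (λ z → colIndex n k (lookupCol z Q)) (rowLabel-rowIndex n k w (rows⇒ (∈-map⁺ proj₂ (rookInColumn i)))) ⟩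
        colIndex n k (lookupCol w Q) ≡⟨ cong (colIndex n k) (lookupCol-unique Q uniqueRows (rookInColumn i)) ⟩
        colIndex n k (colLabel n k i) ≡⟨ colIndex-colLabel n k i ⟩
        i ∎
      where w = lookupRow (colLabel n k i) Q

    π : Permutation′ (suc (n + k))
    π = permutation f f⁻¹ f∘f⁻¹ f⁻¹∘f

    Q⊆graph : ∀ {q} → q ∈ Q → q ∈ graph n k π
    Q⊆graph {c , w} m = subst (λ z → (c , z) ∈ graph n k π) rowOfπ≡w (OnLabels.∈graph⇐ π okc)
      where
      okc = cols⇒ (∈-map⁺ proj₁ m)
      rowOfπ≡w : OnLabels.rowOfπ π c ≡ w
      rowOfπ≡w = begin
        rowLabel n k (rowIndex n k (lookupRow (colLabel n k (colIndex n k c)) Q))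
          ≡⟨ cong (λ z → rowLabel n k (rowIndex n k (lookupRow z Q))) (colLabel-colIndex n k c okc) ⟩
        rowLabel n k (rowIndex n k (lookupRow c Q)) ≡⟨ cong (rowLabel n k ∘ rowIndex n k) (lookupRow-unique Q uniqueCols m) ⟩
        rowLabel n k (rowIndex n k w) ≡⟨ rowLabel-rowIndex n k w (rows⇒ (∈-map⁺ proj₂ m)) ⟩
        w ∎

    π∈E : InE n k π
    π∈E i = admissible⇒excedance⇔ i (π ⟨$⟩ʳ i) (admissibleRooks rook)
      where
      rook : (colLabel n k i , rowLabel n k (f i)) ∈ Q
      rook = subst (λ z → (colLabel n k i , z) ∈ Q)
                   (sym (rowLabel-rowIndex n k _ (rows⇒ (∈-map⁺ proj₂ (rookInColumn i))))) (rookInColumn i)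

-- x followed by y in a chain: the rook of column y stands in row x.
ChainStep : Sym → Sym → Set
ChainStep (blue x) (blue y) = y < x
ChainStep (red x) (red y) = x < y
ChainStep _ _ = ⊥

IsChain : List Sym → Set
IsChain [] = ⊤
IsChain (x ∷ []) = ⊤
IsChain (x ∷ y ∷ ys) = ChainStep x y × IsChain (y ∷ ys)

chainRooks : List Sym → List Rook
chainRooks [] = []
chainRooks (x ∷ []) = []
chainRooks (x ∷ y ∷ ys) = (y , x) ∷ chainRooks (y ∷ ys)

chainStep⇒admissible : ∀ w c → ChainStep w c → Admissible c w
chainStep⇒admissible (blue x) (blue y) s = s
chainStep⇒admissible (red x) (red y) s = s

chainStep-color : ∀ x y → ChainStep x y → color y ≡ color x
chainStep-color (red _) (red _) _ = refl
chainStep-color (blue _) (blue _) _ = refl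

¬chainStep-blue0 : ∀ y → ¬ ChainStep (blue 0) y
¬chainStep-blue0 (blue y) ()

-- A block is a blue chain t ∷ bs followed by a red chain l ∷ rs (written reversed in the
-- word); in the last block the red chain starts at 0ʳ.
data Block : Set where
  block : (t : Sym) (bs : List Sym) (l : Sym) (rs : List Sym) → Block

data LastBlock : Set where
  lastBlock : (t : Sym) (bs : List Sym) (rs : List Sym) → LastBlock

Chain : Set
Chain = Sym × List Sym

letters : Chain → List Sym
letters (x , xs) = x ∷ xs

blockChains : Block → List Chain
blockChains (block t bs l rs) = (t , bs) ∷ (l , rs) ∷ []

lastBlockChains : LastBlock → List Chain
lastBlockChains (lastBlock t bs rs) = (t , bs) ∷ (red 0 , rs) ∷ []

chains : List Block → LastBlock → List Chain
chains [] f = lastBlockChains f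
chains (e ∷ es) f = blockChains e ++ chains es f

blockWord : Block → List Sym
blockWord (block t bs l rs) = t ∷ bs ++ reverse (l ∷ rs)

word : List Block → LastBlock → List Sym
word [] (lastBlock t bs rs) = t ∷ bs ++ reverse (red 0 ∷ rs)
word (e ∷ es) f = blockWord e ++ word es f

wordInit : List Block → LastBlock → List Sym
wordInit [] (lastBlock t bs rs) = t ∷ bs ++ reverse rs
wordInit (e ∷ es) f = blockWord e ++ wordInit es f

chainLetters : List Chain → List Sym
chainLetters = concatMap letters

allChainRooks : List Chain → List Rook
allChainRooks = concatMap (chainRooks ∘ letters)

IsBlock : Block → Set
IsBlock (block t bs l rs) = color t ≡ b × color l ≡ r × IsChain (t ∷ bs) × IsChain (l ∷ rs)

IsLastBlock : LastBlock → Set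
IsLastBlock (lastBlock t bs rs) = color t ≡ b × IsChain (t ∷ bs) × IsChain (red 0 ∷ rs)

record IsDecomposition (n k : ℕ) (es : List Block) (f : LastBlock) : Set where
  field
    blocksOK : All IsBlock es
    lastBlockOK : IsLastBlock f
    uniqueLetters : Unique (word es f)
    letters⇒ : ∀ {z} → z ∈ word es f → IsLetter n k z
    letters⇐ : ∀ {z} → IsLetter n k z → z ∈ word es f

word≡wordInit∷ʳred0 : ∀ es f → word es f ≡ wordInit es f ∷ʳ red 0
word≡wordInit∷ʳred0 [] (lastBlock t bs rs) =
  cong (t ∷_) (trans (cong (bs ++_) (unfold-reverse (red 0) rs)) (sym (++-assoc bs (reverse rs) _)))
word≡wordInit∷ʳred0 (e ∷ es) f =
  trans (cong (blockWord e ++_) (word≡wordInit∷ʳred0 es f)) (sym (++-assoc (blockWord e) (wordInit es f) _))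

word↭chainLetters : ∀ es f → word es f ↭ chainLetters (chains es f)
word↭chainLetters [] (lastBlock t bs rs) =
  ↭-trans (++⁺ˡ (t ∷ bs) (↭-reverse (red 0 ∷ rs))) (↭-reflexive (cong ((t ∷ bs) ++_) (sym (++-identityʳ (red 0 ∷ rs)))))
word↭chainLetters (block t bs l rs ∷ es) f =
  ↭-trans (↭-reflexive (++-assoc (t ∷ bs) (reverse (l ∷ rs)) (word es f)))
          (++⁺ˡ (t ∷ bs) (++⁺ (↭-reverse (l ∷ rs)) (word↭chainLetters es f)))

HeadNotColored : Color → List Sym → Set
HeadNotColored c [] = ⊤
HeadNotColored c (y ∷ _) = color y ≢ c

AllColored : Color → List Sym → Set
AllColored c = All (λ z → color z ≡ c)

All-reverse : ∀ {P : Sym → Set} xs → All P xs → All P (reverse xs)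
All-reverse xs = All-resp-↭ (↭-sym (↭-reverse xs))

reverse-∷≢[] : ∀ (l : Sym) rs → reverse (l ∷ rs) ≢ []
reverse-∷≢[] l rs e = ∷ʳ≢[] (reverse rs) (trans (sym (unfold-reverse l rs)) e)
  where
  ∷ʳ≢[] : ∀ (ys : List Sym) → ys ∷ʳ l ≢ []
  ∷ʳ≢[] [] ()
  ∷ʳ≢[] (_ ∷ _) ()

reverse-∷∷ : ∀ (x y : Sym) ys → reverse (x ∷ y ∷ ys) ≡ reverse ys ++ y ∷ x ∷ []
reverse-∷∷ x y ys =
  trans (unfold-reverse x (y ∷ ys)) (trans (cong (_∷ʳ x) (unfold-reverse y ys)) (++-assoc (reverse ys) (y ∷ []) (x ∷ [])))

HeadNotColored-++ : ∀ c c' xs ys → AllColored c' xs → c' ≢ c → (xs ≡ [] → HeadNotColored c ys) →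
                    HeadNotColored c (xs ++ ys)
HeadNotColored-++ c c' [] ys _ _ h = h refl
HeadNotColored-++ c c' (x ∷ xs) ys (cx ∷ _) c'≢c _ = λ e → c'≢c (trans (sym cx) e)

IsChain-monochrome : ∀ x xs → IsChain (x ∷ xs) → AllColored (color x) (x ∷ xs)
IsChain-monochrome x [] _ = refl ∷ []
IsChain-monochrome x (y ∷ ys) (s , ok) =
  refl ∷ subst (λ c → AllColored c (y ∷ ys)) (chainStep-color x y s) (IsChain-monochrome y ys ok)

blueChain-colored : ∀ t bs → color t ≡ b → IsChain (t ∷ bs) → AllColored b (t ∷ bs)
blueChain-colored t bs ct ok = subst (λ c → AllColored c (t ∷ bs)) ct (IsChain-monochrome t bs ok)

reversedRedChain-colored : ∀ l rs → color l ≡ r → IsChain (l ∷ rs) → AllColored r (reverse (l ∷ rs))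
reversedRedChain-colored l rs cl ok = All-reverse (l ∷ rs) (subst (λ c → AllColored c (l ∷ rs)) cl (IsChain-monochrome l rs ok))

wordHead-notRed : ∀ es f → All IsBlock es → IsLastBlock f → HeadNotColored r (word es f)
wordHead-notRed [] (lastBlock t bs rs) _ (ct , _) = λ e → b≢r (trans (sym ct) e)
wordHead-notRed (block t bs l rs ∷ es) f ((ct , _) ∷ _) _ = λ e → b≢r (trans (sym ct) e)

pairRook-colors≢ : ∀ x y → color x ≢ color y → pairRook x y ≡ []
pairRook-colors≢ (red x) (red y) x≢y = ⊥-elim (x≢y refl)
pairRook-colors≢ (red x) (blue y) _ = refl
pairRook-colors≢ (blue x) (red y) _ = refl
pairRook-colors≢ (blue x) (blue y) x≢y = ⊥-elim (x≢y refl)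

step1-++ : ∀ c xs ys → AllColored c xs → HeadNotColored c ys → step1 (xs ++ ys) ≡ step1 xs ++ step1 ys
step1-++ c [] ys _ _ = refl
step1-++ c (x ∷ []) [] _ _ = refl
step1-++ c (x ∷ []) (y ∷ ys) (cx ∷ _) hn rewrite pairRook-colors≢ x y (λ e → hn (trans (sym e) cx)) = refl
step1-++ c (x ∷ x' ∷ xs) ys (_ ∷ cxs) hn =
  trans (cong (pairRook x x' ++_) (step1-++ c (x' ∷ xs) ys cxs hn))
        (sym (++-assoc (pairRook x x') (step1 (x' ∷ xs)) (step1 ys)))

step1-blueChain : ∀ x xs → color x ≡ b → IsChain (x ∷ xs) → step1 (x ∷ xs) ≡ chainRooks (x ∷ xs)
step1-blueChain x [] _ _ = refl
step1-blueChain (blue x) (blue y ∷ ys) _ (_ , ok) = cong ((blue y , blue x) ∷_) (step1-blueChain (blue y) ys refl ok)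

step1-∷ʳ : ∀ zs y x → step1 (zs ++ y ∷ x ∷ []) ≡ step1 (zs ++ y ∷ []) ++ pairRook y x
step1-∷ʳ [] y x = ++-identityʳ (pairRook y x)
step1-∷ʳ (z ∷ []) y x =
  trans (cong (pairRook z y ++_) (++-identityʳ (pairRook y x))) (sym (cong (_++ pairRook y x) (++-identityʳ (pairRook z y))))
step1-∷ʳ (z ∷ z' ∷ zs) y x =
  trans (cong (pairRook z z' ++_) (step1-∷ʳ (z' ∷ zs) y x))
        (sym (++-assoc (pairRook z z') (step1 (z' ∷ zs ++ y ∷ [])) (pairRook y x)))

step1-reverse-redChain : ∀ x xs → color x ≡ r → IsChain (x ∷ xs) → step1 (reverse (x ∷ xs)) ≡ reverse (chainRooks (x ∷ xs))
step1-reverse-redChain x [] _ _ = refl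
step1-reverse-redChain (red x) (red y ∷ ys) _ (_ , ok) = begin
    step1 (reverse (red x ∷ red y ∷ ys))                 ≡⟨ cong step1 (reverse-∷∷ (red x) (red y) ys) ⟩
    step1 (reverse ys ++ red y ∷ red x ∷ [])             ≡⟨ step1-∷ʳ (reverse ys) (red y) (red x) ⟩
    step1 (reverse ys ++ red y ∷ []) ++ (red y , red x) ∷ []
      ≡⟨ cong (λ z → step1 z ++ (red y , red x) ∷ []) (sym (unfold-reverse (red y) ys)) ⟩
    step1 (reverse (red y ∷ ys)) ++ (red y , red x) ∷ []
      ≡⟨ cong (_++ (red y , red x) ∷ []) (step1-reverse-redChain (red y) ys refl ok) ⟩
    reverse (chainRooks (red y ∷ ys)) ++ (red y , red x) ∷ [] ≡⟨ sym (unfold-reverse (red y , red x) (chainRooks (red y ∷ ys))) ⟩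
    reverse (chainRooks (red x ∷ red y ∷ ys)) ∎
  where open ≡-Reasoning

step1-word : ∀ es f → All IsBlock es → IsLastBlock f → step1 (word es f) ↭ allChainRooks (chains es f)
step1-word [] (lastBlock t bs rs) _ (ct , okb , okr) = begin
    step1 ((t ∷ bs) ++ reverse (red 0 ∷ rs))
      ≡⟨ step1-++ b (t ∷ bs) _ (blueChain-colored t bs ct okb)
           (subst (HeadNotColored b) (++-identityʳ _)
             (HeadNotColored-++ b r (reverse (red 0 ∷ rs)) [] (reversedRedChain-colored (red 0) rs refl okr) r≢b (λ _ → tt))) ⟩
    step1 (t ∷ bs) ++ step1 (reverse (red 0 ∷ rs))
      ≡⟨ cong₂ _++_ (step1-blueChain t bs ct okb) (step1-reverse-redChain (red 0) rs refl okr) ⟩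
    chainRooks (t ∷ bs) ++ reverse (chainRooks (red 0 ∷ rs))
      ↭⟨ ++⁺ˡ (chainRooks (t ∷ bs)) (↭-trans (↭-reverse (chainRooks (red 0 ∷ rs))) (↭-reflexive (sym (++-identityʳ _)))) ⟩
    chainRooks (t ∷ bs) ++ chainRooks (red 0 ∷ rs) ++ [] ∎
  where open PermutationReasoning
step1-word (block t bs l rs ∷ es) f ((ct , cl , okb , okr) ∷ oks) okf = begin
    step1 ((t ∷ bs ++ reverse (l ∷ rs)) ++ word es f)
      ≡⟨ cong step1 (++-assoc (t ∷ bs) (reverse (l ∷ rs)) (word es f)) ⟩
    step1 ((t ∷ bs) ++ (reverse (l ∷ rs) ++ word es f))
      ≡⟨ step1-++ b (t ∷ bs) _ (blueChain-colored t bs ct okb)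
           (HeadNotColored-++ b r (reverse (l ∷ rs)) (word es f) redRun r≢b (⊥-elim ∘ reverse-∷≢[] l rs)) ⟩
    step1 (t ∷ bs) ++ step1 (reverse (l ∷ rs) ++ word es f)
      ≡⟨ cong (step1 (t ∷ bs) ++_) (step1-++ r (reverse (l ∷ rs)) (word es f) redRun (wordHead-notRed es f oks okf)) ⟩
    step1 (t ∷ bs) ++ (step1 (reverse (l ∷ rs)) ++ step1 (word es f))
      ≡⟨ cong₂ (λ u v → u ++ (v ++ step1 (word es f))) (step1-blueChain t bs ct okb) (step1-reverse-redChain l rs cl okr) ⟩
    chainRooks (t ∷ bs) ++ (reverse (chainRooks (l ∷ rs)) ++ step1 (word es f))
      ↭⟨ ++⁺ˡ (chainRooks (t ∷ bs)) (++⁺ (↭-reverse (chainRooks (l ∷ rs))) (step1-word es f oks okf)) ⟩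
    chainRooks (t ∷ bs) ++ (chainRooks (l ∷ rs) ++ allChainRooks (chains es f)) ∎
  where
  open PermutationReasoning
  redRun = reversedRedChain-colored l rs cl okr

∈-filterᵇ⁻ : ∀ (p : Sym → Bool) xs {w} → w ∈ filterᵇ p xs → w ∈ xs × p w ≡ true
∈-filterᵇ⁻ p xs m with ∈-filter⁻ (T? ∘ p) {xs = xs} m
... | w∈ , pw = w∈ , Equivalence.to T-≡ pw

∈-filterᵇ⁺ : ∀ (p : Sym → Bool) {xs w} → w ∈ xs → p w ≡ true → w ∈ filterᵇ p xs
∈-filterᵇ⁺ p w∈ pw = ∈-filter⁺ (T? ∘ p) w∈ (Equivalence.from T-≡ pw)

Unique-filterᵇ : ∀ (p : Sym → Bool) {xs} → Unique xs → Unique (filterᵇ p xs)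
Unique-filterᵇ p = Unique.filter⁺ (T? ∘ p)

filterᵇ-congOn : ∀ (p q : Sym → Bool) xs → (∀ w → w ∈ xs → p w ≡ q w) → filterᵇ p xs ≡ filterᵇ q xs
filterᵇ-congOn p q [] _ = refl
filterᵇ-congOn p q (x ∷ xs) p≗q rewrite p≗q x (here refl) with q x
... | true = cong (x ∷_) (filterᵇ-congOn p q xs (λ w m → p≗q w (there m)))
... | false = filterᵇ-congOn p q xs (λ w m → p≗q w (there m))

eligible : Color → List Rook → Sym → Bool
eligible c P w = not (color w ==C c) ∧ not (rowOccupied w P)

freeRows : Color → List Rook → List Sym → List Sym
freeRows c P = filterᵇ (eligible c P)

eligible-intro : ∀ c P w → (color w ==C c) ≡ false → w ∉ map proj₂ P → eligible c P w ≡ true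
eligible-intro c P w e w∉ rewrite e | ∉⇒rowOccupied-false w P w∉ = refl

eligible⇒colors≢ : ∀ c P w → eligible c P w ≡ true → (color w ==C c) ≡ false
eligible⇒colors≢ c P w e with color w ==C c
eligible⇒colors≢ c P w () | true
... | false = refl

eligible⇒rowFree : ∀ c P w → eligible c P w ≡ true → w ∉ map proj₂ P
eligible⇒rowFree c P w e m with color w ==C c
eligible⇒rowFree c P w () m | true
... | false rewrite ∈⇒rowOccupied w P m with e
... | ()

eligible-∷ : ∀ c x a P w → eligible c ((x , a) ∷ P) w ≡ (eligible c P w ∧ not (a ==S w))
eligible-∷ c x a P w = reassoc (color w ==C c) (a ==S w) (rowOccupied w P)
  where
  reassoc : ∀ X Y Z → (not X ∧ not (Y ∨ Z)) ≡ ((not X ∧ not Z) ∧ not Y)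
  reassoc true Y Z = refl
  reassoc false true true = refl
  reassoc false true false = refl
  reassoc false false true = refl
  reassoc false false false = refl

topFreeRow≡head : ∀ c rows P → topFreeRow c rows P ≡ Data.List.head (freeRows c P rows)
topFreeRow≡head c [] P = refl
topFreeRow≡head c (w ∷ ws) P with eligible c P w
... | true = refl
... | false = topFreeRow≡head c ws P

step2-occupied : ∀ rows x xs P → colOccupied x P ≡ true → step2 rows (x ∷ xs) P ≡ step2 rows xs P
step2-occupied rows x xs P e rewrite e = refl

step2-occupiedPrefix : ∀ rows ys xs P → (∀ z → z ∈ ys → colOccupied z P ≡ true) → step2 rows (ys ++ xs) P ≡ step2 rows xs P
step2-occupiedPrefix rows [] xs P _ = refl
step2-occupiedPrefix rows (y ∷ ys) xs P occ =
  trans (step2-occupied rows y (ys ++ xs) P (occ y (here refl))) (step2-occupiedPrefix rows ys xs P (λ z m → occ z (there m)))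

step2-free : ∀ rows x xs P a q → colOccupied x P ≡ false → freeRows (color x) P rows ≡ a ∷ q →
             step2 rows (x ∷ xs) P ≡ step2 rows xs ((x , a) ∷ P)
step2-free rows x xs P a q e₁ e₂ rewrite e₁ | topFreeRow≡head (color x) rows P | e₂ = refl

freeRows-take : ∀ c x P a q rows → Unique rows → freeRows c P rows ≡ a ∷ q → freeRows c ((x , a) ∷ P) rows ≡ q
freeRows-take c x P a q (w ∷ ws) (w∉ ∷ u) e with eligible c P w in eq
... | true with e
... | refl rewrite eligible-∷ c x w P w | eq | ==S-refl w = filterᵇ-congOn _ _ ws rest
  where
  rest : ∀ w' → w' ∈ ws → eligible c ((x , w) ∷ P) w' ≡ eligible c P w'
  rest w' m rewrite eligible-∷ c x w P w' | ≢⇒==S-false w w' (λ { refl → All¬⇒¬Any w∉ m }) = ∧-identityʳ _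
freeRows-take c x P a q (w ∷ ws) (_ ∷ u) e | false rewrite eligible-∷ c x a P w | eq = freeRows-take c x P a q ws u e

freeRows-otherColor : ∀ c x P a rows → color a ≡ other c → freeRows (other c) ((x , a) ∷ P) rows ≡ freeRows (other c) P rows
freeRows-otherColor c x P a rows ca = filterᵇ-congOn _ _ rows λ w _ → trans (eligible-∷ (other c) x a P w) (drop w)
  where
  drop : ∀ w → (eligible (other c) P w ∧ not (a ==S w)) ≡ eligible (other c) P w
  drop w with a ==S w in eq
  ... | false = ∧-identityʳ _
  ... | true with ==S⇒≡ a w eq
  ... | refl rewrite ca | ==C-refl (other c) = refl

freeRows-head-color : ∀ c P rows {a q} → freeRows c P rows ≡ a ∷ q → color a ≡ other c
freeRows-head-color c P rows {a} e with ∈-filterᵇ⁻ (eligible c P) rows (subst (a ∈_) (sym e) (here refl))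
... | _ , el = ==C-false⇒other (color a) c (eligible⇒colors≢ c P a el)

heads : List Block → LastBlock → List Sym
heads [] (lastBlock t _ _) = t ∷ []
heads (block t _ l _ ∷ es) f = t ∷ l ∷ heads es f

-- The columns filled by step (1).
tails : List Block → LastBlock → List Sym
tails [] (lastBlock t bs rs) = bs ++ reverse rs
tails (block t bs l rs ∷ es) f = (bs ++ reverse rs) ++ tails es f

-- The rooks of step (2): the i-th blue head t gets the i-th row of Qr, the i-th red head l
-- the i-th row of Qb.
crossRooks : List Block → LastBlock → List Sym → List Sym → List Rook
crossRooks [] (lastBlock t _ _) (a ∷ _) _ = (t , a) ∷ []
crossRooks [] _ [] _ = []
crossRooks (block t _ l _ ∷ es) f (a ∷ Qr) (c ∷ Qb) = crossRooks es f Qr Qb ++ (l , c) ∷ (t , a) ∷ []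
crossRooks (_ ∷ _) _ _ _ = []

blockWord-split : ∀ (t : Sym) bs l rs xs → (t ∷ bs ++ reverse (l ∷ rs)) ++ xs ≡ t ∷ (bs ++ reverse rs) ++ l ∷ xs
blockWord-split t bs l rs xs = cong (t ∷_) (begin
    (bs ++ reverse (l ∷ rs)) ++ xs        ≡⟨ cong (λ z → (bs ++ z) ++ xs) (unfold-reverse l rs) ⟩
    (bs ++ (reverse rs ++ l ∷ [])) ++ xs  ≡⟨ cong (_++ xs) (sym (++-assoc bs (reverse rs) (l ∷ []))) ⟩
    ((bs ++ reverse rs) ++ l ∷ []) ++ xs  ≡⟨ ++-assoc (bs ++ reverse rs) (l ∷ []) xs ⟩
    (bs ++ reverse rs) ++ l ∷ xs ∎)
  where open ≡-Reasoning

module _ (rows : List Sym) (uniqueRows : Unique rows) where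

  -- Step (2) walks through the blocks: each head finds its column empty and takes the first
  -- free row of the other colour, each tail finds its column already filled by step (1).
  step2-blocks : ∀ es f P Qr Qb → All IsBlock es → IsLastBlock f → Unique (heads es f) →
    (∀ z → z ∈ heads es f → colOccupied z P ≡ false) →
    (∀ z → z ∈ tails es f → colOccupied z P ≡ true) →
    freeRows b P rows ≡ Qr → freeRows r P rows ≡ Qb →
    length Qr ≡ suc (length es) → length Qb ≡ length es →
    step2 rows (wordInit es f) P ≡ just (crossRooks es f Qr Qb ++ P)
  step2-blocks [] (lastBlock t bs rs) P (a ∷ Qr) Qb _ (ct , _) _ headsFree tailsFilled eQr _ _ _ = begin
      step2 rows (t ∷ bs ++ reverse rs) P
        ≡⟨ step2-free rows t (bs ++ reverse rs) P a Qr (headsFree t (here refl)) (subst (λ c → freeRows c P rows ≡ a ∷ Qr) (sym ct) eQr) ⟩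
      step2 rows (bs ++ reverse rs) ((t , a) ∷ P)
        ≡⟨ cong (λ z → step2 rows z ((t , a) ∷ P)) (sym (++-identityʳ (bs ++ reverse rs))) ⟩
      step2 rows ((bs ++ reverse rs) ++ []) ((t , a) ∷ P)
        ≡⟨ step2-occupiedPrefix rows (bs ++ reverse rs) [] ((t , a) ∷ P) (λ z m → colOccupied-mono z (t , a) P (tailsFilled z m)) ⟩
      just ((t , a) ∷ P) ∎
    where open ≡-Reasoning
  step2-blocks (block t bs l rs ∷ es) f P (a ∷ Qr) (c ∷ Qb) ((ct , cl , _) ∷ oks) okf (t∉ ∷ l∉ ∷ uh)
               headsFree tailsFilled eQr eQb lr lb = begin
      step2 rows ((t ∷ bs ++ reverse (l ∷ rs)) ++ wordInit es f) P
        ≡⟨ cong (λ z → step2 rows z P) (blockWord-split t bs l rs (wordInit es f)) ⟩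
      step2 rows (t ∷ (bs ++ reverse rs) ++ l ∷ wordInit es f) P
        ≡⟨ step2-free rows t _ P a Qr (headsFree t (here refl)) (subst (λ c' → freeRows c' P rows ≡ a ∷ Qr) (sym ct) eQr) ⟩
      step2 rows ((bs ++ reverse rs) ++ l ∷ wordInit es f) P₁
        ≡⟨ step2-occupiedPrefix rows (bs ++ reverse rs) _ P₁ (λ z m → colOccupied-mono z (t , a) P (tailsFilled z (∈-++⁺ˡ m))) ⟩
      step2 rows (l ∷ wordInit es f) P₁
        ≡⟨ step2-free rows l _ P₁ c Qb (trans (colOccupied-cons-other l t a P t≢l) (headsFree l (there (here refl))))
             (subst (λ c' → freeRows c' P₁ rows ≡ c ∷ Qb) (sym cl) eQb₁) ⟩
      step2 rows (wordInit es f) P₂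
        ≡⟨ step2-blocks es f P₂ Qr Qb oks okf uh headsFree₂ tailsFilled₂ eQr₂ eQb₂ (cong pred lr) (cong pred lb) ⟩
      just (crossRooks es f Qr Qb ++ P₂)
        ≡⟨ cong just (sym (++-assoc (crossRooks es f Qr Qb) ((l , c) ∷ (t , a) ∷ []) P)) ⟩
      just ((crossRooks es f Qr Qb ++ (l , c) ∷ (t , a) ∷ []) ++ P) ∎
    where
    open ≡-Reasoning
    P₁ = (t , a) ∷ P
    P₂ = (l , c) ∷ P₁
    t≢l : t ≢ l
    t≢l e = b≢r (trans (sym ct) (trans (cong color e) cl))
    ca : color a ≡ other b
    ca = freeRows-head-color b P rows eQr
    eQb₁ : freeRows r P₁ rows ≡ c ∷ Qb
    eQb₁ = trans (freeRows-otherColor b t P a rows ca) eQb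
    headsFree₂ : ∀ z → z ∈ heads es f → colOccupied z P₂ ≡ false
    headsFree₂ z m = trans (colOccupied-cons-other z l c P₁ (λ { refl → All¬⇒¬Any l∉ m }))
                    (trans (colOccupied-cons-other z t a P (λ { refl → All¬⇒¬Any t∉ (there m) })) (headsFree z (there (there m))))
    tailsFilled₂ : ∀ z → z ∈ tails es f → colOccupied z P₂ ≡ true
    tailsFilled₂ z m = colOccupied-mono z (l , c) P₁ (colOccupied-mono z (t , a) P (tailsFilled z (∈-++⁺ʳ (bs ++ reverse rs) m)))
    eQr₂ : freeRows b P₂ rows ≡ Qr
    eQr₂ = trans (freeRows-otherColor r l P₁ c rows (freeRows-head-color r P₁ rows eQb₁)) (freeRows-take b t P a Qr rows uniqueRows eQr)
    eQb₂ : freeRows r P₂ rows ≡ Qb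
    eQb₂ = freeRows-take r l P₁ c Qb rows uniqueRows eQb₁

chainInit : Sym → List Sym → List Sym
chainInit x [] = []
chainInit x (y ∷ ys) = x ∷ chainInit y ys

chainLast : Sym → List Sym → Sym
chainLast x [] = x
chainLast x (y ∷ ys) = chainLast y ys

chainHeads : List Chain → List Sym
chainHeads = map proj₁

chainTails : List Chain → List Sym
chainTails = concatMap proj₂

chainInits : List Chain → List Sym
chainInits = concatMap (λ (x , xs) → chainInit x xs)

chainLasts : List Chain → List Sym
chainLasts = map (λ (x , xs) → chainLast x xs)

AllChains : List Chain → Set
AllChains = All (IsChain ∘ letters)

∷≡chainInit++chainLast : ∀ x xs → x ∷ xs ≡ chainInit x xs ++ chainLast x xs ∷ []
∷≡chainInit++chainLast x [] = refl
∷≡chainInit++chainLast x (y ∷ ys) = cong (x ∷_) (∷≡chainInit++chainLast y ys)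

chainLast-∈ : ∀ x xs → chainLast x xs ∈ x ∷ xs
chainLast-∈ x [] = here refl
chainLast-∈ x (y ∷ ys) = there (chainLast-∈ y ys)

chainRooks-cols : ∀ x xs → map proj₁ (chainRooks (x ∷ xs)) ≡ xs
chainRooks-cols x [] = refl
chainRooks-cols x (y ∷ ys) = cong (y ∷_) (chainRooks-cols y ys)

chainRooks-rows : ∀ x xs → map proj₂ (chainRooks (x ∷ xs)) ≡ chainInit x xs
chainRooks-rows x [] = refl
chainRooks-rows x (y ∷ ys) = cong (x ∷_) (chainRooks-rows y ys)

chainRooks-step : ∀ x xs → IsChain (x ∷ xs) → ∀ {c w} → (c , w) ∈ chainRooks (x ∷ xs) → ChainStep w c
chainRooks-step x (y ∷ ys) (s , _) (here refl) = s
chainRooks-step x (y ∷ ys) (_ , ok) (there m) = chainRooks-step y ys ok m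

chainInit-step : ∀ x xs → IsChain (x ∷ xs) → ∀ {z} → z ∈ chainInit x xs → Σ Sym (ChainStep z)
chainInit-step x (y ∷ ys) (s , _) (here refl) = y , s
chainInit-step x (y ∷ ys) (_ , ok) (there m) = chainInit-step y ys ok m

chainLast-color : ∀ x xs → IsChain (x ∷ xs) → color (chainLast x xs) ≡ color x
chainLast-color x [] _ = refl
chainLast-color x (y ∷ ys) (s , ok) = trans (chainLast-color y ys ok) (chainStep-color x y s)

chainLetters↭heads++tails : ∀ cs → chainLetters cs ↭ chainHeads cs ++ chainTails cs
chainLetters↭heads++tails [] = ↭-refl
chainLetters↭heads++tails ((x , xs) ∷ cs) = prep x (begin
    xs ++ chainLetters cs                   ↭⟨ ++⁺ˡ xs (chainLetters↭heads++tails cs) ⟩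
    xs ++ chainHeads cs ++ chainTails cs   ↭⟨ shifts xs (chainHeads cs) ⟩
    chainHeads cs ++ xs ++ chainTails cs ∎)
  where open PermutationReasoning

chainLetters↭inits++lasts : ∀ cs → chainLetters cs ↭ chainInits cs ++ chainLasts cs
chainLetters↭inits++lasts [] = ↭-refl
chainLetters↭inits++lasts ((x , xs) ∷ cs) = begin
    (x ∷ xs) ++ chainLetters cs          ≡⟨ cong (_++ chainLetters cs) (∷≡chainInit++chainLast x xs) ⟩
    (initₓ ++ lastₓ ∷ []) ++ chainLetters cs  ≡⟨ ++-assoc initₓ _ _ ⟩
    initₓ ++ lastₓ ∷ chainLetters cs     ↭⟨ ++⁺ˡ initₓ (prep lastₓ (chainLetters↭inits++lasts cs)) ⟩
    initₓ ++ lastₓ ∷ chainInits cs ++ chainLasts cs  ↭⟨ ++⁺ˡ initₓ (↭-sym (shift lastₓ (chainInits cs) (chainLasts cs))) ⟩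
    initₓ ++ chainInits cs ++ lastₓ ∷ chainLasts cs  ≡⟨ sym (++-assoc initₓ (chainInits cs) _) ⟩
    (initₓ ++ chainInits cs) ++ lastₓ ∷ chainLasts cs ∎
  where
  open PermutationReasoning
  initₓ = chainInit x xs
  lastₓ = chainLast x xs

allChainRooks-cols : ∀ cs → map proj₁ (allChainRooks cs) ≡ chainTails cs
allChainRooks-cols [] = refl
allChainRooks-cols ((x , xs) ∷ cs) =
  trans (map-++ proj₁ (chainRooks (x ∷ xs)) (allChainRooks cs)) (cong₂ _++_ (chainRooks-cols x xs) (allChainRooks-cols cs))

allChainRooks-rows : ∀ cs → map proj₂ (allChainRooks cs) ≡ chainInits cs
allChainRooks-rows [] = refl
allChainRooks-rows ((x , xs) ∷ cs) =
  trans (map-++ proj₂ (chainRooks (x ∷ xs)) (allChainRooks cs)) (cong₂ _++_ (chainRooks-rows x xs) (allChainRooks-rows cs))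

∈-chainLetters⁻ : ∀ cs {z} → z ∈ chainLetters cs → Σ Chain λ ch → ch ∈ cs × z ∈ letters ch
∈-chainLetters⁻ ((x , xs) ∷ cs) m with ∈-++⁻ (x ∷ xs) m
... | inj₁ m₁ = (x , xs) , here refl , m₁
... | inj₂ m₂ with ∈-chainLetters⁻ cs m₂
... | ch , ch∈ , z∈ = ch , there ch∈ , z∈

∈-chainLetters⁺ : ∀ cs {ch z} → ch ∈ cs → z ∈ letters ch → z ∈ chainLetters cs
∈-chainLetters⁺ ((x , xs) ∷ cs) (here refl) z∈ = ∈-++⁺ˡ z∈
∈-chainLetters⁺ ((x , xs) ∷ cs) (there ch∈) z∈ = ∈-++⁺ʳ (x ∷ xs) (∈-chainLetters⁺ cs ch∈ z∈)

∈-chainInits⁻ : ∀ cs {z} → z ∈ chainInits cs → Σ Chain λ ch → ch ∈ cs × z ∈ chainInit (proj₁ ch) (proj₂ ch)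
∈-chainInits⁻ ((x , xs) ∷ cs) m with ∈-++⁻ (chainInit x xs) m
... | inj₁ m₁ = (x , xs) , here refl , m₁
... | inj₂ m₂ with ∈-chainInits⁻ cs m₂
... | ch , ch∈ , z∈ = ch , there ch∈ , z∈

∈-chainInits⁺ : ∀ cs {ch z} → ch ∈ cs → z ∈ chainInit (proj₁ ch) (proj₂ ch) → z ∈ chainInits cs
∈-chainInits⁺ ((x , xs) ∷ cs) (here refl) z∈ = ∈-++⁺ˡ z∈
∈-chainInits⁺ ((x , xs) ∷ cs) (there ch∈) z∈ = ∈-++⁺ʳ (chainInit x xs) (∈-chainInits⁺ cs ch∈ z∈)

∈-allChainRooks⁻ : ∀ cs {q} → q ∈ allChainRooks cs → Σ Chain λ ch → ch ∈ cs × q ∈ chainRooks (letters ch)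
∈-allChainRooks⁻ ((x , xs) ∷ cs) m with ∈-++⁻ (chainRooks (x ∷ xs)) m
... | inj₁ m₁ = (x , xs) , here refl , m₁
... | inj₂ m₂ with ∈-allChainRooks⁻ cs m₂
... | ch , ch∈ , q∈ = ch , there ch∈ , q∈

∈-allChainRooks⁺ : ∀ cs {ch q} → ch ∈ cs → q ∈ chainRooks (letters ch) → q ∈ allChainRooks cs
∈-allChainRooks⁺ ((x , xs) ∷ cs) (here refl) q∈ = ∈-++⁺ˡ q∈
∈-allChainRooks⁺ ((x , xs) ∷ cs) (there ch∈) q∈ = ∈-++⁺ʳ (chainRooks (x ∷ xs)) (∈-allChainRooks⁺ cs ch∈ q∈)

allChainRooks-step : ∀ cs → AllChains cs → ∀ {c w} → (c , w) ∈ allChainRooks cs → ChainStep w c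
allChainRooks-step cs oks m with ∈-allChainRooks⁻ cs m
... | (x , xs) , ch∈ , q∈ = chainRooks-step x xs (lookup oks ch∈) q∈

chainInits-step : ∀ cs → AllChains cs → ∀ {z} → z ∈ chainInits cs → Σ Sym (ChainStep z)
chainInits-step cs oks m with ∈-chainInits⁻ cs m
... | (x , xs) , ch∈ , z∈ = chainInit-step x xs (lookup oks ch∈) z∈

chains-areChains : ∀ es f → All IsBlock es → IsLastBlock f → AllChains (chains es f)
chains-areChains [] (lastBlock t bs rs) _ (_ , okb , okr) = okb ∷ okr ∷ []
chains-areChains (block t bs l rs ∷ es) f ((_ , _ , okb , okr) ∷ oks) okf = okb ∷ okr ∷ chains-areChains es f oks okf

chainHeads-chains : ∀ es f → chainHeads (chains es f) ≡ heads es f ∷ʳ red 0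
chainHeads-chains [] (lastBlock t bs rs) = refl
chainHeads-chains (block t bs l rs ∷ es) f = cong (λ z → t ∷ l ∷ z) (chainHeads-chains es f)

chainTails-chains : ∀ es f → chainTails (chains es f) ↭ tails es f
chainTails-chains [] (lastBlock t bs rs) =
  ↭-trans (↭-reflexive (cong (bs ++_) (++-identityʳ rs))) (++⁺ˡ bs (↭-sym (↭-reverse rs)))
chainTails-chains (block t bs l rs ∷ es) f =
  ↭-trans (↭-reflexive (sym (++-assoc bs rs _))) (++⁺ (++⁺ˡ bs (↭-sym (↭-reverse rs))) (chainTails-chains es f))

blueLasts : List Block → LastBlock → List Sym
blueLasts [] (lastBlock t bs rs) = chainLast t bs ∷ []
blueLasts (block t bs l rs ∷ es) f = chainLast t bs ∷ blueLasts es f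

redLasts : List Block → LastBlock → List Sym
redLasts [] (lastBlock t bs rs) = chainLast (red 0) rs ∷ []
redLasts (block t bs l rs ∷ es) f = chainLast l rs ∷ redLasts es f

chainLasts↭ : ∀ es f → chainLasts (chains es f) ↭ blueLasts es f ++ redLasts es f
chainLasts↭ [] (lastBlock t bs rs) = ↭-refl
chainLasts↭ (block t bs l rs ∷ es) f =
  prep (chainLast t bs) (↭-trans (prep (chainLast l rs) (chainLasts↭ es f)) (↭-sym (shift (chainLast l rs) (blueLasts es f) (redLasts es f))))

length-blueLasts : ∀ es f → length (blueLasts es f) ≡ suc (length es)
length-blueLasts [] (lastBlock _ _ _) = refl
length-blueLasts (block _ _ _ _ ∷ es) f = cong suc (length-blueLasts es f)

length-redLasts : ∀ es f → length (redLasts es f) ≡ suc (length es)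
length-redLasts [] (lastBlock _ _ _) = refl
length-redLasts (block _ _ _ _ ∷ es) f = cong suc (length-redLasts es f)

blueLasts-colored : ∀ es f → All IsBlock es → IsLastBlock f → ∀ {z} → z ∈ blueLasts es f → color z ≡ b
blueLasts-colored [] (lastBlock t bs rs) _ (ct , okb , _) (here refl) = trans (chainLast-color t bs okb) ct
blueLasts-colored (block t bs l rs ∷ es) f ((ct , _ , okb , _) ∷ _) _ (here refl) = trans (chainLast-color t bs okb) ct
blueLasts-colored (block t bs l rs ∷ es) f (_ ∷ oks) okf (there m) = blueLasts-colored es f oks okf m

redLasts-colored : ∀ es f → All IsBlock es → IsLastBlock f → ∀ {z} → z ∈ redLasts es f → color z ≡ r
redLasts-colored [] (lastBlock t bs rs) _ (_ , _ , okr) (here refl) = chainLast-color (red 0) rs okr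
redLasts-colored (block t bs l rs ∷ es) f ((_ , cl , _ , okr) ∷ _) _ (here refl) = trans (chainLast-color l rs okr) cl
redLasts-colored (block t bs l rs ∷ es) f (_ ∷ oks) okf (there m) = redLasts-colored es f oks okf m

crossRooks-cols : ∀ es f Qr Qb → length Qr ≡ suc (length es) → length Qb ≡ length es →
                  map proj₁ (crossRooks es f Qr Qb) ↭ heads es f
crossRooks-cols [] (lastBlock t _ _) (a ∷ Qr) Qb _ _ = ↭-refl
crossRooks-cols (block t bs l rs ∷ es) f (a ∷ Qr) (c ∷ Qb) lr lb = begin
    map proj₁ (crossRooks es f Qr Qb ++ (l , c) ∷ (t , a) ∷ []) ≡⟨ map-++ proj₁ (crossRooks es f Qr Qb) _ ⟩
    map proj₁ (crossRooks es f Qr Qb) ++ l ∷ t ∷ []  ↭⟨ ++⁺ʳ _ (crossRooks-cols es f Qr Qb (cong pred lr) (cong pred lb)) ⟩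
    heads es f ++ l ∷ t ∷ []                         ↭⟨ ++-comm (heads es f) _ ⟩
    l ∷ t ∷ heads es f                               ↭⟨ swap l t ↭-refl ⟩
    t ∷ l ∷ heads es f ∎
  where open PermutationReasoning

crossRooks-rows : ∀ es f Qr Qb → length Qr ≡ suc (length es) → length Qb ≡ length es →
                  map proj₂ (crossRooks es f Qr Qb) ↭ Qr ++ Qb
crossRooks-rows [] (lastBlock t _ _) (a ∷ []) [] _ _ = ↭-refl
crossRooks-rows (block t bs l rs ∷ es) f (a ∷ Qr) (c ∷ Qb) lr lb = begin
    map proj₂ (crossRooks es f Qr Qb ++ (l , c) ∷ (t , a) ∷ []) ≡⟨ map-++ proj₂ (crossRooks es f Qr Qb) _ ⟩
    map proj₂ (crossRooks es f Qr Qb) ++ c ∷ a ∷ []  ↭⟨ ++⁺ʳ _ (crossRooks-rows es f Qr Qb (cong pred lr) (cong pred lb)) ⟩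
    (Qr ++ Qb) ++ c ∷ a ∷ []                         ↭⟨ ++-comm (Qr ++ Qb) _ ⟩
    c ∷ a ∷ Qr ++ Qb                                 ↭⟨ swap c a ↭-refl ⟩
    a ∷ c ∷ Qr ++ Qb                                 ↭⟨ prep a (↭-sym (shift c Qr Qb)) ⟩
    a ∷ Qr ++ c ∷ Qb ∎
  where open PermutationReasoning

∈-crossRooks⁻ : ∀ es f Qr Qb → All IsBlock es → IsLastBlock f → ∀ {c w} → (c , w) ∈ crossRooks es f Qr Qb →
                (color c ≡ b × w ∈ Qr) ⊎ (color c ≡ r × w ∈ Qb)
∈-crossRooks⁻ [] (lastBlock t _ _) (a ∷ Qr) Qb _ (ct , _) (here refl) = inj₁ (ct , here refl)
∈-crossRooks⁻ (block t bs l rs ∷ es) f (a ∷ Qr) (c ∷ Qb) ((ct , cl , _) ∷ oks) okf m with ∈-++⁻ (crossRooks es f Qr Qb) m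
... | inj₂ (here refl) = inj₂ (cl , here refl)
... | inj₂ (there (here refl)) = inj₁ (ct , here refl)
... | inj₁ m' with ∈-crossRooks⁻ es f Qr Qb oks okf m'
... | inj₁ (cb , w∈) = inj₁ (cb , there w∈)
... | inj₂ (cr , w∈) = inj₂ (cr , there w∈)

module _ (n k : ℕ) where

  rowsTopToBottom⇒isRowLabel : ∀ {w} → w ∈ rowsTopToBottom n k → IsRowLabel n k w
  rowsTopToBottom⇒isRowLabel m with ∈-++⁻ (map (λ j → blue (suc j)) (upTo k)) m
  ... | inj₁ m' with ∈-map⁻ (λ j → blue (suc j)) m'
  ... | j , j∈ , refl = s≤s z≤n , ∈-upTo⁻ j∈
  rowsTopToBottom⇒isRowLabel m | inj₂ m' with ∈-map⁻ red m'
  ... | x , x∈ , refl = s≤s⁻¹ (∈-upTo⁻ x∈)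

  isRowLabel⇒rowsTopToBottom : ∀ {w} → IsRowLabel n k w → w ∈ rowsTopToBottom n k
  isRowLabel⇒rowsTopToBottom {red x} x≤n = ∈-++⁺ʳ (map (λ j → blue (suc j)) (upTo k)) (∈-map⁺ red (∈-upTo⁺ (s≤s x≤n)))
  isRowLabel⇒rowsTopToBottom {blue (suc y)} (_ , y<k) = ∈-++⁺ˡ (∈-map⁺ (λ j → blue (suc j)) (∈-upTo⁺ y<k))

  Unique-rowsTopToBottom : Unique (rowsTopToBottom n k)
  Unique-rowsTopToBottom =
    Unique-++ (Unique.map⁺ (suc-injective ∘ blue-injective) (Unique.upTo⁺ k)) (Unique.map⁺ red-injective (Unique.upTo⁺ (suc n)))
              disjoint
    where
    disjoint : ∀ {w} → w ∈ map (λ j → blue (suc j)) (upTo k) → w ∈ map red (upTo (suc n)) → ⊥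
    disjoint m₁ m₂ with ∈-map⁻ (λ j → blue (suc j)) m₁ | ∈-map⁻ red m₂
    ... | _ , _ , refl | _ , _ , ()

-- After step (1) the occupied rows are the non-last chain letters, so the free rows of
-- each colour are the last letters of the chains of that colour (0ᵇ is not a row): one
-- more red than blue free row, exactly as step (2) needs.
module OnDecomposition (n k : ℕ) (es : List Block) (f : LastBlock) (dec : IsDecomposition n k es f) where
  open IsDecomposition dec

  rows : List Sym
  rows = rowsTopToBottom n k

  cs : List Chain
  cs = chains es f

  chainsOK : AllChains cs
  chainsOK = chains-areChains es f blocksOK lastBlockOK

  rooks₁ : List Rook
  rooks₁ = step1 (word es f)

  Qr Qb : List Sym
  Qr = freeRows b rooks₁ rows
  Qb = freeRows r rooks₁ rows

  rooks : List Rook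
  rooks = crossRooks es f Qr Qb ++ rooks₁

  rooks₁↭ : rooks₁ ↭ allChainRooks cs
  rooks₁↭ = step1-word es f blocksOK lastBlockOK

  rooks₁-cols : map proj₁ rooks₁ ↭ chainTails cs
  rooks₁-cols = ↭-trans (map⁺ proj₁ rooks₁↭) (↭-reflexive (allChainRooks-cols cs))

  rooks₁-rows : map proj₂ rooks₁ ↭ chainInits cs
  rooks₁-rows = ↭-trans (map⁺ proj₂ rooks₁↭) (↭-reflexive (allChainRooks-rows cs))

  word⇒chainLetters : ∀ {z} → z ∈ word es f → z ∈ chainLetters cs
  word⇒chainLetters = ∈-↭ (word↭chainLetters es f)

  chainLetters⇒letter : ∀ {z} → z ∈ chainLetters cs → IsLetter n k z
  chainLetters⇒letter = letters⇒ ∘ ∈-↭ (↭-sym (word↭chainLetters es f))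

  letter⇒chainLetters : ∀ {z} → IsLetter n k z → z ∈ chainLetters cs
  letter⇒chainLetters = word⇒chainLetters ∘ letters⇐

  Unique-chainLetters : Unique (chainLetters cs)
  Unique-chainLetters = Unique-↭ (word↭chainLetters es f) uniqueLetters

  Unique-inits++lasts : Unique (chainInits cs ++ chainLasts cs)
  Unique-inits++lasts = Unique-↭ (chainLetters↭inits++lasts cs) Unique-chainLetters

  heads++red0 : chainHeads cs ++ chainTails cs ≡ heads es f ++ red 0 ∷ chainTails cs
  heads++red0 = trans (cong (_++ chainTails cs) (chainHeads-chains es f)) (++-assoc (heads es f) (red 0 ∷ []) (chainTails cs))

  Unique-red0∷heads++tails : Unique (red 0 ∷ heads es f ++ chainTails cs)
  Unique-red0∷heads++tails =
    Unique-↭ (↭-trans (↭-trans (chainLetters↭heads++tails cs) (↭-reflexive heads++red0)) (shift (red 0) (heads es f) (chainTails cs)))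
             Unique-chainLetters

  Unique-heads++tails : Unique (heads es f ++ chainTails cs)
  Unique-heads++tails = Unique-tail Unique-red0∷heads++tails

  headsFree : ∀ z → z ∈ heads es f → colOccupied z rooks₁ ≡ false
  headsFree z m = ∉⇒colOccupied-false z rooks₁ (Unique-++-disjoint (heads es f) Unique-heads++tails m ∘ ∈-↭ rooks₁-cols)

  tailsFilled : ∀ z → z ∈ tails es f → colOccupied z rooks₁ ≡ true
  tailsFilled z m = ∈⇒colOccupied z rooks₁ (∈-↭ (↭-sym rooks₁-cols) (∈-↭ (↭-sym (chainTails-chains es f)) m))

  inits⊎lasts : ∀ {z} → z ∈ chainLetters cs → z ∈ chainInits cs ⊎ z ∈ chainLasts cs
  inits⊎lasts m = ∈-++⁻ (chainInits cs) (∈-↭ (chainLetters↭inits++lasts cs) m)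

  lasts⇒chainLetters : ∀ {z} → z ∈ chainLasts cs → z ∈ chainLetters cs
  lasts⇒chainLetters m = ∈-↭ (↭-sym (chainLetters↭inits++lasts cs)) (∈-++⁺ʳ (chainInits cs) m)

  lasts⇒blue⊎red : ∀ {z} → z ∈ chainLasts cs → z ∈ blueLasts es f ⊎ z ∈ redLasts es f
  lasts⇒blue⊎red m = ∈-++⁻ (blueLasts es f) (∈-↭ (chainLasts↭ es f) m)

  blueLasts⇒lasts : ∀ {z} → z ∈ blueLasts es f → z ∈ chainLasts cs
  blueLasts⇒lasts m = ∈-↭ (↭-sym (chainLasts↭ es f)) (∈-++⁺ˡ m)

  redLasts⇒lasts : ∀ {z} → z ∈ redLasts es f → z ∈ chainLasts cs
  redLasts⇒lasts m = ∈-↭ (↭-sym (chainLasts↭ es f)) (∈-++⁺ʳ (blueLasts es f) m)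

  lasts∉inits : ∀ {z} → z ∈ chainLasts cs → z ∉ chainInits cs
  lasts∉inits m m' = Unique-++-disjoint (chainInits cs) Unique-inits++lasts m' m

  Unique-blueLasts++redLasts : Unique (blueLasts es f ++ redLasts es f)
  Unique-blueLasts++redLasts = Unique-↭ (chainLasts↭ es f) (Unique-++ʳ (chainInits cs) Unique-inits++lasts)

  notInit⇒rowFree : ∀ {z} → z ∉ chainInits cs → z ∉ map proj₂ rooks₁
  notInit⇒rowFree z∉ = z∉ ∘ ∈-↭ rooks₁-rows

  blue0∈lasts : blue 0 ∈ chainLasts cs
  blue0∈lasts with inits⊎lasts (letter⇒chainLetters {blue 0} z≤n)
  ... | inj₂ m = m
  ... | inj₁ m = ⊥-elim (¬chainStep-blue0 _ (proj₂ (chainInits-step cs chainsOK m)))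

  init⇒isRowLabel : ∀ {z} → z ∈ chainInits cs → IsRowLabel n k z
  init⇒isRowLabel {z} m =
    letter⇒row z (chainLetters⇒letter (∈-↭ (↭-sym (chainLetters↭inits++lasts cs)) (∈-++⁺ˡ m)))
      (λ { refl → ¬chainStep-blue0 _ (proj₂ (chainInits-step cs chainsOK m)) })

  freeRow-color : ∀ c {w} → w ∈ freeRows c rooks₁ rows → (color w ==C c) ≡ false
  freeRow-color c {w} m = eligible⇒colors≢ c rooks₁ w (proj₂ (∈-filterᵇ⁻ _ rows m))

  freeRow⇒last : ∀ c {w} → w ∈ freeRows c rooks₁ rows → w ∈ chainLasts cs
  freeRow⇒last c {w} m with ∈-filterᵇ⁻ (eligible c rooks₁) rows m
  ... | w∈ , el with inits⊎lasts (letter⇒chainLetters (row⇒letter w (rowsTopToBottom⇒isRowLabel n k w∈)))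
  ... | inj₁ wInit = ⊥-elim (eligible⇒rowFree c rooks₁ w el (∈-↭ (↭-sym rooks₁-rows) wInit))
  ... | inj₂ wLast = wLast

  notInit⇒freeRow : ∀ c {w} → IsRowLabel n k w → (color w ==C c) ≡ false → w ∉ chainInits cs → w ∈ freeRows c rooks₁ rows
  notInit⇒freeRow c {w} roww colors≢ w∉ =
    ∈-filterᵇ⁺ (eligible c rooks₁) (isRowLabel⇒rowsTopToBottom n k roww) (eligible-intro c rooks₁ w colors≢ (notInit⇒rowFree w∉))

  last⇒freeRow : ∀ c {w} → w ∈ chainLasts cs → w ≢ blue 0 → (color w ==C c) ≡ false → w ∈ freeRows c rooks₁ rows
  last⇒freeRow c {w} m w≢0 colors≢ =
    notInit⇒freeRow c (letter⇒row w (chainLetters⇒letter (lasts⇒chainLetters m)) w≢0) colors≢ (lasts∉inits m)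

  Qr↭redLasts : Qr ↭ redLasts es f
  Qr↭redLasts = Unique⇒↭ (Unique-filterᵇ _ (Unique-rowsTopToBottom n k)) (Unique-++ʳ (blueLasts es f) Unique-blueLasts++redLasts) to from
    where
    to : ∀ {w} → w ∈ Qr → w ∈ redLasts es f
    to {w} m with lasts⇒blue⊎red (freeRow⇒last b m)
    ... | inj₂ wRed = wRed
    ... | inj₁ wBlue with freeRow-color b m
    ... | e rewrite blueLasts-colored es f blocksOK lastBlockOK wBlue with e
    ... | ()
    from : ∀ {w} → w ∈ redLasts es f → w ∈ Qr
    from {w} m with redLasts-colored es f blocksOK lastBlockOK m
    ... | cw = last⇒freeRow b (redLasts⇒lasts m) (λ { refl → r≢b (sym cw) }) (subst (λ c → (c ==C b) ≡ false) (sym cw) refl)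

  blueLasts↭blue0∷Qb : blueLasts es f ↭ blue 0 ∷ Qb
  blueLasts↭blue0∷Qb =
    Unique⇒↭ (Unique-++ˡ (blueLasts es f) Unique-blueLasts++redLasts)
             (Unique-cons (¬row-blue0 {n} {k} ∘ rowsTopToBottom⇒isRowLabel n k ∘ proj₁ ∘ ∈-filterᵇ⁻ _ rows)
                          (Unique-filterᵇ _ (Unique-rowsTopToBottom n k)))
             to from
    where
    to : ∀ {w} → w ∈ blueLasts es f → w ∈ blue 0 ∷ Qb
    to {w} m with w ≟S blue 0
    ... | yes refl = here refl
    ... | no w≢0 = there (last⇒freeRow r (blueLasts⇒lasts m) w≢0
                     (subst (λ c → (c ==C r) ≡ false) (sym (blueLasts-colored es f blocksOK lastBlockOK m)) refl))
    from : ∀ {w} → w ∈ blue 0 ∷ Qb → w ∈ blueLasts es f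
    from (here refl) with lasts⇒blue⊎red blue0∈lasts
    ... | inj₁ m = m
    ... | inj₂ m with redLasts-colored es f blocksOK lastBlockOK m
    ... | ()
    from {w} (there m) with lasts⇒blue⊎red (freeRow⇒last r m)
    ... | inj₁ wBlue = wBlue
    ... | inj₂ wRed with freeRow-color r m
    ... | e rewrite redLasts-colored es f blocksOK lastBlockOK wRed with e
    ... | ()

  length-Qr : length Qr ≡ suc (length es)
  length-Qr = trans (↭-length Qr↭redLasts) (length-redLasts es f)

  length-Qb : length Qb ≡ length es
  length-Qb = suc-injective (trans (sym (↭-length blueLasts↭blue0∷Qb)) (length-blueLasts es f))

  step2-word : step2 rows (wordInit es f) rooks₁ ≡ just rooks
  step2-word = step2-blocks rows (Unique-rowsTopToBottom n k) es f rooks₁ Qr Qb blocksOK lastBlockOK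
                 (Unique-++ˡ (heads es f) Unique-heads++tails) headsFree tailsFilled refl refl length-Qr length-Qb

  rooks-cols : map proj₁ rooks ↭ heads es f ++ chainTails cs
  rooks-cols = ↭-trans (↭-reflexive (map-++ proj₁ (crossRooks es f Qr Qb) rooks₁))
                       (++⁺ (crossRooks-cols es f Qr Qb length-Qr length-Qb) rooks₁-cols)

  rooks-rows : map proj₂ rooks ↭ (Qr ++ Qb) ++ chainInits cs
  rooks-rows = ↭-trans (↭-reflexive (map-++ proj₂ (crossRooks es f Qr Qb) rooks₁))
                       (++⁺ (crossRooks-rows es f Qr Qb length-Qr length-Qb) rooks₁-rows)

  crossRook-colors≢ : ∀ {c w} → (c , w) ∈ crossRooks es f Qr Qb → color c ≢ color w
  crossRook-colors≢ {c} {w} m with ∈-crossRooks⁻ es f Qr Qb blocksOK lastBlockOK m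
  ... | inj₁ (cb , w∈) = λ e → contradiction (freeRow-color b w∈) (trans (sym e) cb)
    where
    contradiction : (color w ==C b) ≡ false → color w ≡ b → ⊥
    contradiction e₁ e₂ rewrite e₂ with e₁
    ... | ()
  ... | inj₂ (cr , w∈) = λ e → contradiction (freeRow-color r w∈) (trans (sym e) cr)
    where
    contradiction : (color w ==C r) ≡ false → color w ≡ r → ⊥
    contradiction e₁ e₂ rewrite e₂ with e₁
    ... | ()

  headOrTail⇒chainLetters : ∀ {z} → z ∈ heads es f ++ chainTails cs → z ∈ chainLetters cs
  headOrTail⇒chainLetters {z} m =
    ∈-↭ (↭-sym (chainLetters↭heads++tails cs)) (subst (z ∈_) (sym heads++red0) (insertRed0 m))
    where
    insertRed0 : z ∈ heads es f ++ chainTails cs → z ∈ heads es f ++ red 0 ∷ chainTails cs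
    insertRed0 m with ∈-++⁻ (heads es f) m
    ... | inj₁ m₁ = ∈-++⁺ˡ m₁
    ... | inj₂ m₂ = ∈-++⁺ʳ (heads es f) (there m₂)

  chainLetters⇒headOrTail : ∀ {z} → z ∈ chainLetters cs → z ≢ red 0 → z ∈ heads es f ++ chainTails cs
  chainLetters⇒headOrTail {z} m z≢0 with ∈-++⁻ (heads es f) (subst (z ∈_) heads++red0 (∈-↭ (chainLetters↭heads++tails cs) m))
  ... | inj₁ m₁ = ∈-++⁺ˡ m₁
  ... | inj₂ (here e) = ⊥-elim (z≢0 e)
  ... | inj₂ (there m₂) = ∈-++⁺ʳ (heads es f) m₂

  freeRow⇒notInit : ∀ {w} → w ∈ Qr ++ Qb → w ∉ chainInits cs
  freeRow⇒notInit m wInit with ∈-++⁻ Qr m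
  ... | inj₁ m₁ = eligible⇒rowFree b rooks₁ _ (proj₂ (∈-filterᵇ⁻ _ rows m₁)) (∈-↭ (↭-sym rooks₁-rows) wInit)
  ... | inj₂ m₂ = eligible⇒rowFree r rooks₁ _ (proj₂ (∈-filterᵇ⁻ _ rows m₂)) (∈-↭ (↭-sym rooks₁-rows) wInit)

  Qr-Qb-disjoint : ∀ {w} → w ∈ Qr → w ∈ Qb → ⊥
  Qr-Qb-disjoint {red _} _ m₂ with freeRow-color r m₂
  ... | ()
  Qr-Qb-disjoint {blue _} m₁ _ with freeRow-color b m₁
  ... | ()

  freeRows⇒isRowLabel : ∀ {w} → w ∈ Qr ++ Qb → IsRowLabel n k w
  freeRows⇒isRowLabel m with ∈-++⁻ Qr m
  ... | inj₁ m₁ = rowsTopToBottom⇒isRowLabel n k (proj₁ (∈-filterᵇ⁻ _ rows m₁))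
  ... | inj₂ m₂ = rowsTopToBottom⇒isRowLabel n k (proj₁ (∈-filterᵇ⁻ _ rows m₂))

  rowLabel⇒rooks : ∀ {w} → IsRowLabel n k w → w ∈ (Qr ++ Qb) ++ chainInits cs
  rowLabel⇒rooks {w} ok with any? (w ≟S_) (chainInits cs) | color≡b⊎r w
  ... | yes wInit | _ = ∈-++⁺ʳ (Qr ++ Qb) wInit
  ... | no w∉ | inj₂ cr = ∈-++⁺ˡ (∈-++⁺ˡ (notInit⇒freeRow b ok (subst (λ c → (c ==C b) ≡ false) (sym cr) refl) w∉))
  ... | no w∉ | inj₁ cb = ∈-++⁺ˡ (∈-++⁺ʳ Qr (notInit⇒freeRow r ok (subst (λ c → (c ==C r) ≡ false) (sym cb) refl) w∉))

  rooks-admissible : ∀ {c w} → (c , w) ∈ rooks → Admissible c w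
  rooks-admissible {c} {w} m with ∈-++⁻ (crossRooks es f Qr Qb) m
  ... | inj₁ mCross = admissible-colors≢ c w (crossRook-colors≢ mCross)
  ... | inj₂ m₁ = chainStep⇒admissible w c (allChainRooks-step cs chainsOK (∈-↭ rooks₁↭ m₁))

  rooks-isFull : IsFullPlacement n k rooks
  rooks-isFull = record
    { uniqueCols = Unique-↭ (↭-sym rooks-cols) Unique-heads++tails
    ; uniqueRows = Unique-↭ (↭-sym rooks-rows)
        (Unique-++ (Unique-++ uQr uQb Qr-Qb-disjoint) (Unique-++ˡ (chainInits cs) Unique-inits++lasts) freeRow⇒notInit)
    ; cols⇒ = λ {c} m → let m' = ∈-↭ rooks-cols m in
        letter⇒column c (chainLetters⇒letter (headOrTail⇒chainLetters m'))
          (λ e → Unique[x∷xs]⇒x∉xs Unique-red0∷heads++tails (subst (_∈ _) e m'))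
    ; cols⇐ = λ {c} ok → ∈-↭ (↭-sym rooks-cols)
        (chainLetters⇒headOrTail (letter⇒chainLetters (column⇒letter c ok)) (λ { refl → ¬column-red0 {n} {k} ok }))
    ; rows⇒ = λ m → [ freeRows⇒isRowLabel , init⇒isRowLabel ]′ (∈-++⁻ (Qr ++ Qb) (∈-↭ rooks-rows m))
    ; rows⇐ = ∈-↭ (↭-sym rooks-rows) ∘ rowLabel⇒rooks
    ; admissibleRooks = rooks-admissible
    }
    where
    uQr = Unique-filterᵇ (eligible b rooks₁) (Unique-rowsTopToBottom n k)
    uQb = Unique-filterᵇ (eligible r rooks₁) (Unique-rowsTopToBottom n k)

-- The rooks of a permutation in Eᵏₙ, read on labels.
record AdmissibleBijection (n k : ℕ) : Set where
  field
    rowOf colOf : Sym → Sym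
    rowOf-isRowLabel : ∀ {c} → IsColumnLabel n k c → IsRowLabel n k (rowOf c)
    colOf-isColumnLabel : ∀ {w} → IsRowLabel n k w → IsColumnLabel n k (colOf w)
    colOf∘rowOf : ∀ {c} → IsColumnLabel n k c → colOf (rowOf c) ≡ c
    rowOf∘colOf : ∀ {w} → IsRowLabel n k w → rowOf (colOf w) ≡ w
    admissible : ∀ {c} → IsColumnLabel n k c → Admissible c (rowOf c)

module ChainsOf {n k : ℕ} (β : AdmissibleBijection n k) where
  open AdmissibleBijection β

  -- The chain through row x goes on to column colOf x.
  Continues : Sym → Set
  Continues x = IsRowLabel n k x × color (colOf x) ≡ color x

  continues? : ∀ x → Dec (Continues x)
  continues? (red y) = (y ≤? n) ×-dec (color (colOf (red y)) ≟C r)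
  continues? (blue y) = ((1 ≤? y) ×-dec (y ≤? k)) ×-dec (color (colOf (blue y)) ≟C b)

  -- A measure that decreases along chains, so fuel n + k + 1 suffices.
  down : Sym → ℕ
  down (blue j) = j
  down (red y) = n ∸ y

  down-step : ∀ x → Continues x → down (colOf x) < down x
  down-step x (rowx , same) =
    decreases x (colOf x) rowx same (colOf-isColumnLabel rowx) (subst (Admissible (colOf x)) (rowOf∘colOf rowx) (admissible (colOf-isColumnLabel rowx)))
    where
    decreases : ∀ x y → IsRowLabel n k x → color y ≡ color x → IsColumnLabel n k y → Admissible y x → down y < down x
    decreases (blue j) (blue y) _ _ _ adm = adm
    decreases (red j) (red y) _ _ (_ , y≤n) adm = ∸-monoʳ-< adm y≤n

  down-bound : ∀ x → IsLetter n k x → down x < suc (n + k)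
  down-bound (blue j) ok = s≤s (≤-trans ok (m≤n+m k n))
  down-bound (red y) ok = s≤s (≤-trans (m∸n≤m n y) (m≤m+n n k))

  chainFromFuel : ℕ → Sym → List Sym
  chainFromFuel zero x = []
  chainFromFuel (suc fuel) x with continues? x
  ... | yes _ = colOf x ∷ chainFromFuel fuel (colOf x)
  ... | no _ = []

  chainFrom : Sym → List Sym
  chainFrom = chainFromFuel (suc (n + k))

  IsChainFrom : Sym → List Sym → Set
  IsChainFrom x [] = ¬ Continues x
  IsChainFrom x (y ∷ ys) = Continues x × colOf x ≡ y × IsChainFrom y ys

  chainFromFuel-isChainFrom : ∀ fuel x → down x < fuel → IsChainFrom x (chainFromFuel fuel x)
  chainFromFuel-isChainFrom (suc fuel) x lt with continues? x
  ... | no ¬cont = ¬cont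
  ... | yes cont = cont , refl , chainFromFuel-isChainFrom fuel (colOf x) (≤-trans (down-step x cont) (s≤s⁻¹ lt))

  chainFrom-isChainFrom : ∀ x → IsLetter n k x → IsChainFrom x (chainFrom x)
  chainFrom-isChainFrom x ok = chainFromFuel-isChainFrom (suc (n + k)) x (down-bound x ok)

  IsChainFrom-unique : ∀ x xs ys → IsChainFrom x xs → IsChainFrom x ys → xs ≡ ys
  IsChainFrom-unique x [] [] _ _ = refl
  IsChainFrom-unique x [] (y ∷ ys) ¬cont (cont , _) = ⊥-elim (¬cont cont)
  IsChainFrom-unique x (y ∷ xs) [] (cont , _) ¬cont = ⊥-elim (¬cont cont)
  IsChainFrom-unique x (y ∷ xs) (y' ∷ ys) (_ , refl , i₁) (_ , refl , i₂) = cong (colOf x ∷_) (IsChainFrom-unique (colOf x) xs ys i₁ i₂)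

  IsChainFrom-down : ∀ x xs → IsChainFrom x xs → ∀ {z} → z ∈ xs → down z < down x
  IsChainFrom-down x (y ∷ ys) (cont , refl , i) (here refl) = down-step x cont
  IsChainFrom-down x (y ∷ ys) (cont , refl , i) (there m) = <-trans (IsChainFrom-down y ys i m) (down-step x cont)

  IsChainFrom-unique-letters : ∀ x xs → IsChainFrom x xs → Unique (x ∷ xs)
  IsChainFrom-unique-letters x [] _ = Unique-cons (λ ()) []
  IsChainFrom-unique-letters x (y ∷ ys) i@(_ , _ , i') =
    Unique-cons (λ m → <-irrefl refl (IsChainFrom-down x (y ∷ ys) i m)) (IsChainFrom-unique-letters y ys i')

  IsChainFrom-next : ∀ x xs → IsChainFrom x xs → ∀ {z} → z ∈ x ∷ xs → Continues z → colOf z ∈ xs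
  IsChainFrom-next x [] ¬cont (here refl) cont = ⊥-elim (¬cont cont)
  IsChainFrom-next x (y ∷ ys) (_ , refl , i) (here refl) _ = here refl
  IsChainFrom-next x (y ∷ ys) (_ , refl , i) (there m) cont = there (IsChainFrom-next y ys i m cont)

  IsChainFrom-last : ∀ x xs → IsChainFrom x xs → ¬ Continues (chainLast x xs)
  IsChainFrom-last x [] ¬cont = ¬cont
  IsChainFrom-last x (y ∷ ys) (_ , refl , i) = IsChainFrom-last y ys i

  IsChainFrom-stop⇒last : ∀ x xs → IsChainFrom x xs → ∀ {z} → z ∈ x ∷ xs → ¬ Continues z → z ≡ chainLast x xs
  IsChainFrom-stop⇒last x [] _ (here refl) _ = refl
  IsChainFrom-stop⇒last x (y ∷ ys) (cont , refl , i) (here refl) ¬cont = ⊥-elim (¬cont cont)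
  IsChainFrom-stop⇒last x (y ∷ ys) (_ , refl , i) (there m) ¬cont = IsChainFrom-stop⇒last y ys i m ¬cont

  IsChainFrom-init⇒continues : ∀ x xs → IsChainFrom x xs → ∀ {z} → z ∈ chainInit x xs → Continues z
  IsChainFrom-init⇒continues x (y ∷ ys) (cont , refl , i) (here refl) = cont
  IsChainFrom-init⇒continues x (y ∷ ys) (_ , refl , i) (there m) = IsChainFrom-init⇒continues y ys i m

  IsChainFrom-continues⇒init : ∀ x xs → IsChainFrom x xs → ∀ {z} → z ∈ x ∷ xs → Continues z → z ∈ chainInit x xs
  IsChainFrom-continues⇒init x [] ¬cont (here refl) cont = ⊥-elim (¬cont cont)
  IsChainFrom-continues⇒init x (y ∷ ys) (_ , refl , i) (here refl) _ = here refl
  IsChainFrom-continues⇒init x (y ∷ ys) (_ , refl , i) (there m) cont = there (IsChainFrom-continues⇒init y ys i m cont)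

  IsChainFrom-color : ∀ x xs → IsChainFrom x xs → ∀ {z} → z ∈ x ∷ xs → color z ≡ color x
  IsChainFrom-color x xs i (here refl) = refl
  IsChainFrom-color x (y ∷ ys) (cont , refl , i) (there m) = trans (IsChainFrom-color y ys i m) (proj₂ cont)

  IsChainFrom-letters : ∀ x xs → IsChainFrom x xs → IsLetter n k x → ∀ {z} → z ∈ x ∷ xs → IsLetter n k z
  IsChainFrom-letters x xs i ok (here refl) = ok
  IsChainFrom-letters x (y ∷ ys) (cont , refl , i) ok (there m) =
    IsChainFrom-letters y ys i (column⇒letter _ (colOf-isColumnLabel (proj₁ cont))) m

  IsChainFrom-rooks : ∀ x xs → IsChainFrom x xs → ∀ {c w} → (c , w) ∈ chainRooks (x ∷ xs) → IsColumnLabel n k c × rowOf c ≡ w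
  IsChainFrom-rooks x (y ∷ ys) (cont , refl , i) (here refl) = colOf-isColumnLabel (proj₁ cont) , rowOf∘colOf (proj₁ cont)
  IsChainFrom-rooks x (y ∷ ys) (_ , refl , i) (there m) = IsChainFrom-rooks y ys i m

  IsChainFrom-isChain : ∀ x xs → IsChainFrom x xs → IsChain (x ∷ xs)
  IsChainFrom-isChain x [] _ = tt
  IsChainFrom-isChain x (y ∷ ys) ((rowx , same) , refl , i) =
    step x (colOf x) same (subst (Admissible (colOf x)) (rowOf∘colOf rowx) (admissible (colOf-isColumnLabel rowx))) ,
    IsChainFrom-isChain (colOf x) ys i
    where
    step : ∀ x y → color y ≡ color x → Admissible y x → ChainStep x y
    step (blue a) (blue c) _ adm = adm
    step (red a) (red c) _ adm = adm

  isChainFrom : ∀ a xs → IsChain (a ∷ xs) → (∀ {c w} → (c , w) ∈ chainRooks (a ∷ xs) → IsColumnLabel n k c × rowOf c ≡ w) →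
                ¬ Continues (chainLast a xs) → IsChainFrom a xs
  isChainFrom a [] _ _ ¬cont = ¬cont
  isChainFrom a (y ∷ ys) (s , ok) rooks∈ ¬cont = (rowa , same) , colOf-a , isChainFrom y ys ok (rooks∈ ∘ there) ¬cont
    where
    rook = rooks∈ (here refl)
    colOf-a : colOf a ≡ y
    colOf-a = trans (cong colOf (sym (proj₂ rook))) (colOf∘rowOf (proj₁ rook))
    rowa : IsRowLabel n k a
    rowa = subst (IsRowLabel n k) (proj₂ rook) (rowOf-isRowLabel (proj₁ rook))
    same : color (colOf a) ≡ color a
    same = trans (cong color colOf-a) (chainStep-color a y s)

  HasPredecessor : Sym → Set
  HasPredecessor z = IsColumnLabel n k z × color (rowOf z) ≡ color z

  IsHead : Sym → Set
  IsHead a = ¬ HasPredecessor a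

  data Ascends : Sym → Sym → Set where
    stay : ∀ {z} → Ascends z z
    step : ∀ {z a} → HasPredecessor z → Ascends (rowOf z) a → Ascends z a

  Ascends-trans : ∀ {x y z} → Ascends x y → Ascends y z → Ascends x z
  Ascends-trans stay q = q
  Ascends-trans (step u p) q = step u (Ascends-trans p q)

  Ascends-color : ∀ {z a} → Ascends z a → color z ≡ color a
  Ascends-color stay = refl
  Ascends-color (step (_ , same) p) = trans (sym same) (Ascends-color p)

  chain⇒Ascends : ∀ a xs → IsChainFrom a xs → ∀ {z} → z ∈ a ∷ xs → Ascends z a
  chain⇒Ascends a xs i (here refl) = stay
  chain⇒Ascends a (y ∷ ys) ((rowa , same) , refl , i) (there m) =
    Ascends-trans (chain⇒Ascends (colOf a) ys i m)
      (step (colOf-isColumnLabel rowa , trans (cong color (rowOf∘colOf rowa)) (sym same))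
            (subst (λ q → Ascends q a) (sym (rowOf∘colOf rowa)) stay))

  Ascends-head-unique : ∀ {z a a'} → Ascends z a → Ascends z a' → IsHead a → IsHead a' → a ≡ a'
  Ascends-head-unique stay stay _ _ = refl
  Ascends-head-unique stay (step u _) head _ = ⊥-elim (head u)
  Ascends-head-unique (step u _) stay _ head' = ⊥-elim (head' u)
  Ascends-head-unique (step _ p) (step _ q) head head' = Ascends-head-unique p q head head'

  Ascends⇒chain : ∀ {z a} → Ascends z a → ∀ xs → IsChainFrom a xs → z ∈ a ∷ xs
  Ascends⇒chain stay xs i = here refl
  Ascends⇒chain {z} (step (colz , same) p) xs i =
    there (subst (_∈ xs) (colOf∘rowOf colz)
      (IsChainFrom-next _ xs i (Ascends⇒chain p xs i) (rowOf-isRowLabel colz , trans (cong color (colOf∘rowOf colz)) (sym same))))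

  -- A measure that decreases going up a chain, so fuel n + k + 1 suffices.
  up : Sym → ℕ
  up (blue j) = k ∸ j
  up (red y) = y

  up-step : ∀ z → HasPredecessor z → up (rowOf z) < up z
  up-step z (colz , same) = decreases z (rowOf z) same (rowOf-isRowLabel colz) (admissible colz)
    where
    decreases : ∀ z y → color y ≡ color z → IsRowLabel n k y → Admissible z y → up y < up z
    decreases (blue j) (blue y) _ (_ , y≤k) adm = ∸-monoʳ-< adm y≤k
    decreases (red x) (red y) _ _ adm = adm

  up-bound : ∀ z → IsLetter n k z → up z < suc (n + k)
  up-bound (blue j) ok = s≤s (≤-trans (m∸n≤m k j) (m≤n+m k n))
  up-bound (red y) ok = s≤s (≤-trans ok (m≤m+n n k))

  ascendFuel : ∀ fuel z → up z < fuel → IsLetter n k z → Σ Sym λ a → Ascends z a × IsHead a × IsLetter n k a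
  ascendFuel (suc fuel) z lt ok with isColumnLabel? n k z
  ... | no ¬col = z , stay , (¬col ∘ proj₁) , ok
  ... | yes colz with color (rowOf z) ≟C color z
  ... | no ¬same = z , stay , (¬same ∘ proj₂) , ok
  ... | yes same with ascendFuel fuel (rowOf z) (≤-trans (up-step z (colz , same)) (s≤s⁻¹ lt)) (row⇒letter _ (rowOf-isRowLabel colz))
  ... | a , p , head , oka = a , step (colz , same) p , head , oka

  ascendToHead : ∀ z → IsLetter n k z → Σ Sym λ a → Ascends z a × IsHead a × IsLetter n k a
  ascendToHead z ok = ascendFuel (suc (n + k)) z (up-bound z ok) ok

  Unique-chainLetters-ofHeads : ∀ cs → All (λ (a , xs) → IsChainFrom a xs) cs → Unique (chainHeads cs) →
    All (IsHead ∘ proj₁) cs → Unique (chainLetters cs)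
  Unique-chainLetters-ofHeads [] _ _ _ = []
  Unique-chainLetters-ofHeads ((a , xs) ∷ cs) (i ∷ is) uh (head ∷ hs) =
    Unique-++ (IsChainFrom-unique-letters a xs i) (Unique-chainLetters-ofHeads cs is (Unique-tail uh) hs) disjoint
    where
    disjoint : ∀ {z} → z ∈ a ∷ xs → z ∈ chainLetters cs → ⊥
    disjoint m₁ m₂ with ∈-chainLetters⁻ cs m₂
    ... | (a' , xs') , ch∈ , m₂' =
      Unique[x∷xs]⇒x∉xs uh (subst (_∈ chainHeads cs) (sym a≡a') (∈-map⁺ proj₁ ch∈))
      where
      a≡a' : a ≡ a'
      a≡a' = Ascends-head-unique (chain⇒Ascends a xs i m₁) (chain⇒Ascends a' xs' (lookup is ch∈) m₂') head (lookup hs ch∈)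

blueHeads : List Block → LastBlock → List Sym
blueHeads [] (lastBlock t _ _) = t ∷ []
blueHeads (block t _ _ _ ∷ es) f = t ∷ blueHeads es f

redHeads : List Block → LastBlock → List Sym
redHeads [] _ = []
redHeads (block _ _ l _ ∷ es) f = l ∷ redHeads es f

heads↭blueHeads++redHeads : ∀ es f → heads es f ↭ blueHeads es f ++ redHeads es f
heads↭blueHeads++redHeads [] (lastBlock t _ _) = ↭-refl
heads↭blueHeads++redHeads (block t _ l _ ∷ es) f =
  prep t (↭-trans (prep l (heads↭blueHeads++redHeads es f)) (↭-sym (shift l (blueHeads es f) (redHeads es f))))

-- Blocks are determined by their heads once the tail of each chain is known from its head.
module BuildBlocks (tailOf : Sym → List Sym) where

  buildBlocks : List Sym → List Sym → List Block
  buildBlocks (t ∷ t' ∷ ts) (l ∷ ls) = block t (tailOf t) l (tailOf l) ∷ buildBlocks (t' ∷ ts) ls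
  buildBlocks _ _ = []

  buildLastBlock : List Sym → List Sym → LastBlock
  buildLastBlock (t ∷ []) _ = lastBlock t (tailOf t) (tailOf (red 0))
  buildLastBlock (t ∷ t' ∷ ts) (l ∷ ls) = buildLastBlock (t' ∷ ts) ls
  buildLastBlock _ _ = lastBlock (blue 0) [] []

  blueHeads-build : ∀ ts ls → length ts ≡ suc (length ls) → blueHeads (buildBlocks ts ls) (buildLastBlock ts ls) ≡ ts
  blueHeads-build (t ∷ []) [] _ = refl
  blueHeads-build (t ∷ t' ∷ ts) (l ∷ ls) e = cong (t ∷_) (blueHeads-build (t' ∷ ts) ls (cong pred e))

  redHeads-build : ∀ ts ls → length ts ≡ suc (length ls) → redHeads (buildBlocks ts ls) (buildLastBlock ts ls) ≡ ls
  redHeads-build (t ∷ []) [] _ = refl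
  redHeads-build (t ∷ t' ∷ ts) (l ∷ ls) e = cong (l ∷_) (redHeads-build (t' ∷ ts) ls (cong pred e))

  HasTailOf : Chain → Set
  HasTailOf (x , xs) = xs ≡ tailOf x

  build-hasTailOf : ∀ ts ls → length ts ≡ suc (length ls) → All HasTailOf (chains (buildBlocks ts ls) (buildLastBlock ts ls))
  build-hasTailOf (t ∷ []) [] _ = refl ∷ refl ∷ []
  build-hasTailOf (t ∷ t' ∷ ts) (l ∷ ls) e = refl ∷ refl ∷ build-hasTailOf (t' ∷ ts) ls (cong pred e)

  build-heads : ∀ es f → All HasTailOf (chains es f) →
    buildBlocks (blueHeads es f) (redHeads es f) ≡ es × buildLastBlock (blueHeads es f) (redHeads es f) ≡ f
  build-heads [] (lastBlock t bs rs) (refl ∷ refl ∷ []) = refl , refl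
  build-heads (block t bs l rs ∷ []) (lastBlock _ _ _) (refl ∷ refl ∷ tails) = refl , proj₂ (build-heads [] _ tails)
  build-heads (block t bs l rs ∷ e@(block _ _ _ _) ∷ es) f (refl ∷ refl ∷ tails) with build-heads (e ∷ es) f tails
  ... | es≡ , f≡ = cong (block t bs l rs ∷_) es≡ , f≡

  build-isBlock : ∀ ts ls → length ts ≡ suc (length ls) →
    (∀ {t} → t ∈ ts → color t ≡ b × IsChain (t ∷ tailOf t)) →
    (∀ {l} → l ∈ ls → color l ≡ r × IsChain (l ∷ tailOf l)) →
    IsChain (red 0 ∷ tailOf (red 0)) →
    All IsBlock (buildBlocks ts ls) × IsLastBlock (buildLastBlock ts ls)
  build-isBlock (t ∷ []) [] _ blueOK _ red0OK = [] , proj₁ (blueOK (here refl)) , proj₂ (blueOK (here refl)) , red0OK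
  build-isBlock (t ∷ t' ∷ ts) (l ∷ ls) e blueOK redOK red0OK
    with build-isBlock (t' ∷ ts) ls (cong pred e) (blueOK ∘ there) (redOK ∘ there) red0OK
  ... | oks , okf = (proj₁ (blueOK (here refl)) , proj₁ (redOK (here refl)) , proj₂ (blueOK (here refl)) , proj₂ (redOK (here refl))) ∷ oks , okf

∈-crossRooks⇒onRow : ∀ (g : Sym → Sym) es f Qr Qb → blueHeads es f ≡ map g Qr → redHeads es f ≡ map g Qb →
  ∀ {c w} → (c , w) ∈ crossRooks es f Qr Qb → c ≡ g w × (w ∈ Qr ⊎ w ∈ Qb)
∈-crossRooks⇒onRow g [] (lastBlock t _ _) (a ∷ Qr) Qb et _ (here refl) = proj₁ (∷-injective et) , inj₁ (here refl)
∈-crossRooks⇒onRow g (block t _ l _ ∷ es) f (a ∷ Qr) (c ∷ Qb) et el m with ∈-++⁻ (crossRooks es f Qr Qb) m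
... | inj₂ (here refl) = proj₁ (∷-injective el) , inj₂ (here refl)
... | inj₂ (there (here refl)) = proj₁ (∷-injective et) , inj₁ (here refl)
... | inj₁ m' with ∈-crossRooks⇒onRow g es f Qr Qb (proj₂ (∷-injective et)) (proj₂ (∷-injective el)) m'
... | e , inj₁ w∈ = e , inj₁ (there w∈)
... | e , inj₂ w∈ = e , inj₂ (there w∈)

crossRooks-onRow⇒heads : ∀ (g : Sym → Sym) es f Qr Qb → length Qr ≡ suc (length es) → length Qb ≡ length es →
  (∀ {c w} → (c , w) ∈ crossRooks es f Qr Qb → g w ≡ c) → map g Qr ≡ blueHeads es f × map g Qb ≡ redHeads es f
crossRooks-onRow⇒heads g [] (lastBlock t _ _) (a ∷ []) [] _ _ onRow = cong (_∷ []) (onRow (here refl)) , refl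
crossRooks-onRow⇒heads g (block t _ l _ ∷ es) f (a ∷ Qr) (c ∷ Qb) lr lb onRow
  with crossRooks-onRow⇒heads g es f Qr Qb (cong pred lr) (cong pred lb) (onRow ∘ ∈-++⁺ˡ)
... | eQr , eQb = cong₂ _∷_ (onRow (∈-++⁺ʳ (crossRooks es f Qr Qb) (there (here refl)))) eQr ,
                  cong₂ _∷_ (onRow (∈-++⁺ʳ (crossRooks es f Qr Qb) (here refl))) eQb

-- The blue (red) heads are the blue (red) columns standing in a row of the other colour,
-- listed in the order of those rows.
module Decoding {n k : ℕ} (β : AdmissibleBijection n k) where
  open AdmissibleBijection β
  open ChainsOf β
  open BuildBlocks chainFrom

  rows : List Sym
  rows = rowsTopToBottom n k

  crossing : Color → Sym → Bool
  crossing c w = not (color w ==C c) ∧ (color (colOf w) ==C c)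

  crossingRows : Color → List Sym
  crossingRows c = filterᵇ (crossing c) rows

  headsOf : Color → List Sym
  headsOf c = map colOf (crossingRows c)

  blocksβ : List Block
  blocksβ = buildBlocks (headsOf b) (headsOf r)

  lastBlockβ : LastBlock
  lastBlockβ = buildLastBlock (headsOf b) (headsOf r)

  csβ : List Chain
  csβ = chains blocksβ lastBlockβ

  crossingRow-facts : ∀ c {w} → w ∈ crossingRows c → IsRowLabel n k w × color w ≡ other c × color (colOf w) ≡ c
  crossingRow-facts c m with ∈-filterᵇ⁻ (crossing c) rows m
  ... | w∈ , e with ∧≡true⇒ e
  ... | e₁ , e₂ = rowsTopToBottom⇒isRowLabel n k w∈ , ==C-false⇒other _ _ (not≡true⇒ e₁) , ==C⇒≡ _ _ e₂

  headsOf-facts : ∀ c {t} → t ∈ headsOf c → IsColumnLabel n k t × color t ≡ c × IsHead t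
  headsOf-facts c m with ∈-map⁻ colOf m
  ... | w , w∈ , refl with crossingRow-facts c w∈
  ... | roww , cw , ccol = colOf-isColumnLabel roww , ccol , λ (_ , same) →
    other≢ c (trans (sym cw) (trans (sym (cong color (rowOf∘colOf roww))) (trans same ccol)))

  head⇒headsOf : ∀ {a} → IsHead a → IsColumnLabel n k a → a ∈ headsOf (color a)
  head⇒headsOf {a} head cola =
    subst (_∈ headsOf (color a)) (colOf∘rowOf cola)
      (∈-map⁺ colOf (∈-filterᵇ⁺ (crossing (color a)) (isRowLabel⇒rowsTopToBottom n k (rowOf-isRowLabel cola)) crosses))
    where
    crosses : crossing (color a) (rowOf a) ≡ true
    crosses rewrite colOf∘rowOf cola | ==C-refl (color a)
                  | ≢⇒==C-false (color (rowOf a)) (color a) (λ same → head (cola , same)) = refl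

  allHeads : List Sym
  allHeads = headsOf b ++ headsOf r ++ red 0 ∷ []

  allHeads-facts : ∀ {a} → a ∈ allHeads → IsLetter n k a × IsHead a
  allHeads-facts m with ∈-++⁻ (headsOf b) m
  ... | inj₁ mb = column⇒letter _ (proj₁ (headsOf-facts b mb)) , proj₂ (proj₂ (headsOf-facts b mb))
  ... | inj₂ m' with ∈-++⁻ (headsOf r) m'
  ... | inj₁ mr = column⇒letter _ (proj₁ (headsOf-facts r mr)) , proj₂ (proj₂ (headsOf-facts r mr))
  ... | inj₂ (here refl) = z≤n , ¬column-red0 {n} {k} ∘ proj₁

  head⇒allHeads : ∀ {a} → IsHead a → IsLetter n k a → a ∈ allHeads
  head⇒allHeads {a} head ok with a ≟S red 0
  ... | yes refl = ∈-++⁺ʳ (headsOf b) (∈-++⁺ʳ (headsOf r) (here refl))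
  ... | no a≢0 with color≡b⊎r a | head⇒headsOf head (letter⇒column a ok a≢0)
  ... | inj₁ cb | a∈ = ∈-++⁺ˡ (subst (λ c → a ∈ headsOf c) cb a∈)
  ... | inj₂ cr | a∈ = ∈-++⁺ʳ (headsOf b) (∈-++⁺ˡ (subst (λ c → a ∈ headsOf c) cr a∈))

  allHeads-blue : ∀ {a} → a ∈ allHeads → color a ≡ b → a ∈ headsOf b
  allHeads-blue m ca with ∈-++⁻ (headsOf b) m
  ... | inj₁ mb = mb
  ... | inj₂ m' with ∈-++⁻ (headsOf r) m'
  ... | inj₁ mr = ⊥-elim (b≢r (trans (sym ca) (proj₁ (proj₂ (headsOf-facts r mr)))))
  allHeads-blue m () | inj₂ m' | inj₂ (here refl)

  colOf-injectiveOnRows : ∀ {w w'} → IsRowLabel n k w → IsRowLabel n k w' → colOf w ≡ colOf w' → w ≡ w'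
  colOf-injectiveOnRows roww roww' e = trans (sym (rowOf∘colOf roww)) (trans (cong rowOf e) (rowOf∘colOf roww'))

  Unique-headsOf : ∀ c → Unique (headsOf c)
  Unique-headsOf c = Unique-map-injectiveOn colOf (crossingRows c) (Unique-filterᵇ _ (Unique-rowsTopToBottom n k))
    (λ m m' → colOf-injectiveOnRows (proj₁ (crossingRow-facts c m)) (proj₁ (crossingRow-facts c m')))

  Unique-allHeads : Unique allHeads
  Unique-allHeads = Unique-++ (Unique-headsOf b) (Unique-++ (Unique-headsOf r) (Unique-cons (λ ()) []) redDisjoint) blueDisjoint
    where
    redDisjoint : ∀ {z} → z ∈ headsOf r → z ∈ red 0 ∷ [] → ⊥
    redDisjoint m (here refl) = ¬column-red0 {n} {k} (proj₁ (headsOf-facts r m))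
    blueDisjoint : ∀ {z} → z ∈ headsOf b → z ∈ headsOf r ++ red 0 ∷ [] → ⊥
    blueDisjoint m m' with ∈-++⁻ (headsOf r) m'
    ... | inj₁ mr = b≢r (trans (sym (proj₁ (proj₂ (headsOf-facts b m)))) (proj₁ (proj₂ (headsOf-facts r mr))))
    ... | inj₂ (here refl) = b≢r (sym (proj₁ (proj₂ (headsOf-facts b m))))

  blueHead-isChainFrom : ∀ {t} → t ∈ headsOf b → IsChainFrom t (chainFrom t)
  blueHead-isChainFrom m = chainFrom-isChainFrom _ (column⇒letter _ (proj₁ (headsOf-facts b m)))

  blueChainEnd : Sym → Sym
  blueChainEnd t = chainLast t (chainFrom t)

  Unique-blueChainEnds : Unique (map blueChainEnd (headsOf b))
  Unique-blueChainEnds = Unique-map-injectiveOn _ (headsOf b) (Unique-headsOf b) λ {t} {t'} m m' e →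
    Ascends-head-unique (chain⇒Ascends t (chainFrom t) (blueHead-isChainFrom m) (chainLast-∈ t (chainFrom t)))
      (subst (λ z → Ascends z t') (sym e) (chain⇒Ascends t' (chainFrom t') (blueHead-isChainFrom m') (chainLast-∈ t' (chainFrom t'))))
      (proj₂ (proj₂ (headsOf-facts b m))) (proj₂ (proj₂ (headsOf-facts b m')))

  blueChainEnd-crossing : ∀ {t} → t ∈ headsOf b → blueChainEnd t ≢ blue 0 → blueChainEnd t ∈ crossingRows r
  blueChainEnd-crossing {t} t∈ z≢0 = ∈-filterᵇ⁺ (crossing r) (isRowLabel⇒rowsTopToBottom n k rowz) crosses
    where
    z = blueChainEnd t
    ich = blueHead-isChainFrom t∈
    cz : color z ≡ b
    cz = trans (IsChainFrom-color t (chainFrom t) ich (chainLast-∈ t (chainFrom t))) (proj₁ (proj₂ (headsOf-facts b t∈)))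
    rowz : IsRowLabel n k z
    rowz = letter⇒row z (IsChainFrom-letters t (chainFrom t) ich (column⇒letter _ (proj₁ (headsOf-facts b t∈)))
                                              (chainLast-∈ t (chainFrom t))) z≢0
    ccol : color (colOf z) ≡ r
    ccol with color≡b⊎r (colOf z)
    ... | inj₂ e = e
    ... | inj₁ e = ⊥-elim (IsChainFrom-last t (chainFrom t) ich (rowz , trans e (sym cz)))
    crosses : crossing r z ≡ true
    crosses rewrite cz | ccol = refl

  stoppingBlue⇒blueChainEnd : ∀ {z} → IsLetter n k z → color z ≡ b → ¬ Continues z → z ∈ map blueChainEnd (headsOf b)
  stoppingBlue⇒blueChainEnd {z} ok cz ¬cont with ascendToHead z ok
  ... | a , z↑a , head , oka = subst (_∈ map blueChainEnd (headsOf b)) (sym z≡end) (∈-map⁺ blueChainEnd a∈)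
    where
    a∈ : a ∈ headsOf b
    a∈ = allHeads-blue (head⇒allHeads head oka) (trans (sym (Ascends-color z↑a)) cz)
    z≡end : z ≡ blueChainEnd a
    z≡end = IsChainFrom-stop⇒last a (chainFrom a) (chainFrom-isChainFrom a oka)
              (Ascends⇒chain z↑a (chainFrom a) (chainFrom-isChainFrom a oka)) ¬cont

  -- Counting these gives one more blue than red head.
  blueChainEnds↭ : map blueChainEnd (headsOf b) ↭ blue 0 ∷ crossingRows r
  blueChainEnds↭ = Unique⇒↭ Unique-blueChainEnds
    (Unique-cons (¬row-blue0 {n} {k} ∘ proj₁ ∘ crossingRow-facts r) (Unique-filterᵇ _ (Unique-rowsTopToBottom n k))) to from
    where
    to : ∀ {z} → z ∈ map blueChainEnd (headsOf b) → z ∈ blue 0 ∷ crossingRows r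
    to m with ∈-map⁻ blueChainEnd m
    ... | t , t∈ , refl with blueChainEnd t ≟S blue 0
    ... | yes e = subst (_∈ blue 0 ∷ crossingRows r) (sym e) (here refl)
    ... | no z≢0 = there (blueChainEnd-crossing t∈ z≢0)
    from : ∀ {z} → z ∈ blue 0 ∷ crossingRows r → z ∈ map blueChainEnd (headsOf b)
    from (here refl) = stoppingBlue⇒blueChainEnd z≤n refl (¬row-blue0 {n} {k} ∘ proj₁)
    from (there m) with crossingRow-facts r m
    ... | roww , cw , ccol = stoppingBlue⇒blueChainEnd (row⇒letter _ roww) cw λ (_ , same) → r≢b (trans (sym ccol) (trans same cw))

  length-headsOf : length (headsOf b) ≡ suc (length (headsOf r))
  length-headsOf =
    trans (sym (length-map _ (headsOf b))) (trans (↭-length blueChainEnds↭) (cong suc (sym (length-map colOf (crossingRows r)))))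

  chainHeads-csβ : chainHeads csβ ↭ allHeads
  chainHeads-csβ = begin
      chainHeads csβ                                         ≡⟨ chainHeads-chains blocksβ lastBlockβ ⟩
      heads blocksβ lastBlockβ ++ red 0 ∷ []                 ↭⟨ ++⁺ʳ _ (heads↭blueHeads++redHeads blocksβ lastBlockβ) ⟩
      (blueHeads blocksβ lastBlockβ ++ redHeads blocksβ lastBlockβ) ++ red 0 ∷ []
        ≡⟨ cong₂ (λ u v → (u ++ v) ++ red 0 ∷ []) (blueHeads-build (headsOf b) (headsOf r) length-headsOf) (redHeads-build (headsOf b) (headsOf r) length-headsOf) ⟩
      (headsOf b ++ headsOf r) ++ red 0 ∷ []                 ≡⟨ ++-assoc (headsOf b) (headsOf r) _ ⟩
      allHeads ∎
    where open PermutationReasoning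

  csβ-facts : ∀ {ch} → ch ∈ csβ → IsLetter n k (proj₁ ch) × IsHead (proj₁ ch) × IsChainFrom (proj₁ ch) (proj₂ ch)
  csβ-facts {a , xs} m with allHeads-facts (∈-↭ chainHeads-csβ (∈-map⁺ proj₁ m))
  ... | oka , head = oka , head ,
    subst (IsChainFrom a) (sym (lookup (build-hasTailOf (headsOf b) (headsOf r) length-headsOf) m)) (chainFrom-isChainFrom a oka)

  letter⇒onChain : ∀ {z} → IsLetter n k z → Σ Chain λ ch → ch ∈ csβ × z ∈ letters ch
  letter⇒onChain {z} ok with ascendToHead z ok
  ... | a , z↑a , head , oka with ∈-map⁻ proj₁ (∈-↭ (↭-sym chainHeads-csβ) (head⇒allHeads head oka))
  ... | (a , xs) , ch∈ , refl = (a , xs) , ch∈ , Ascends⇒chain z↑a xs (proj₂ (proj₂ (csβ-facts ch∈)))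

  isDecomposition : IsDecomposition n k blocksβ lastBlockβ
  isDecomposition = record
    { blocksOK = proj₁ blocksOK
    ; lastBlockOK = proj₂ blocksOK
    ; uniqueLetters = Unique-↭ (↭-sym (word↭chainLetters blocksβ lastBlockβ))
        (Unique-chainLetters-ofHeads csβ (tabulate (proj₂ ∘ proj₂ ∘ csβ-facts)) (Unique-↭ (↭-sym chainHeads-csβ) Unique-allHeads)
                                     (tabulate (proj₁ ∘ proj₂ ∘ csβ-facts)))
    ; letters⇒ = chainLetters⇒letter ∘ ∈-↭ (word↭chainLetters blocksβ lastBlockβ)
    ; letters⇐ = λ ok → let (ch , ch∈ , z∈) = letter⇒onChain ok in
        ∈-↭ (↭-sym (word↭chainLetters blocksβ lastBlockβ)) (∈-chainLetters⁺ csβ ch∈ z∈)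
    }
    where
    blocksOK = build-isBlock (headsOf b) (headsOf r) length-headsOf
      (λ m → proj₁ (proj₂ (headsOf-facts b m)) , IsChainFrom-isChain _ _ (blueHead-isChainFrom m))
      (λ m → proj₁ (proj₂ (headsOf-facts r m)) , IsChainFrom-isChain _ _ (chainFrom-isChainFrom _ (column⇒letter _ (proj₁ (headsOf-facts r m)))))
      (IsChainFrom-isChain _ _ (chainFrom-isChainFrom (red 0) z≤n))
    chainLetters⇒letter : ∀ {z} → z ∈ chainLetters csβ → IsLetter n k z
    chainLetters⇒letter m with ∈-chainLetters⁻ csβ m
    ... | (a , xs) , ch∈ , z∈ = IsChainFrom-letters a xs (proj₂ (proj₂ (csβ-facts ch∈))) (proj₁ (csβ-facts ch∈)) z∈

  freeRows≡crossingRows : ∀ c P → (∀ {w} → IsRowLabel n k w → rowOccupied w P ≡ true ⇔ Continues w) →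
                          freeRows c P rows ≡ crossingRows c
  freeRows≡crossingRows c P occupied⇔ = filterᵇ-congOn _ _ rows λ w m → eligible≡crossing w (rowsTopToBottom⇒isRowLabel n k m)
    where
    eligible≡crossing : ∀ w → IsRowLabel n k w → eligible c P w ≡ crossing c w
    eligible≡crossing w roww with color w ==C c in ecw
    ... | true = refl
    ... | false with continues? w
    ... | yes cont rewrite Equivalence.from (occupied⇔ roww) cont | proj₂ cont | ecw = refl
    ... | no ¬cont with rowOccupied w P in eo
    ... | true = ⊥-elim (¬cont (Equivalence.to (occupied⇔ roww) eo))
    ... | false rewrite ≢∧≢⇒≡ {color (colOf w)} {color w} {c} (λ same → ¬cont (roww , same)) (==C-false⇒≢ _ _ ecw)
                      | ==C-refl c = refl

  open OnDecomposition n k blocksβ lastBlockβ isDecomposition using (rooks; rooks₁; rooks₁↭; rooks₁-rows; Qr; Qb)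

  init⇔continues : ∀ {w} → w ∈ chainInits csβ ⇔ Continues w
  init⇔continues {w} = mk⇔ to from
    where
    to : w ∈ chainInits csβ → Continues w
    to m with ∈-chainInits⁻ csβ m
    ... | (a , xs) , ch∈ , w∈ = IsChainFrom-init⇒continues a xs (proj₂ (proj₂ (csβ-facts ch∈))) w∈
    from : Continues w → w ∈ chainInits csβ
    from cont with letter⇒onChain (row⇒letter _ (proj₁ cont))
    ... | (a , xs) , ch∈ , w∈ = ∈-chainInits⁺ csβ ch∈ (IsChainFrom-continues⇒init a xs (proj₂ (proj₂ (csβ-facts ch∈))) w∈ cont)

  rowOccupied⇔continues : ∀ {w} → IsRowLabel n k w → rowOccupied w rooks₁ ≡ true ⇔ Continues w
  rowOccupied⇔continues {w} _ = mk⇔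
    (λ occ → Equivalence.to init⇔continues (∈-↭ rooks₁-rows (rowOccupied⇒∈ w rooks₁ occ)))
    (λ cont → ∈⇒rowOccupied w rooks₁ (∈-↭ (↭-sym rooks₁-rows) (Equivalence.from init⇔continues cont)))

  freeRows≡ : ∀ c → freeRows c rooks₁ rows ≡ crossingRows c
  freeRows≡ c = freeRows≡crossingRows c rooks₁ rowOccupied⇔continues

  blueHeads≡ : blueHeads blocksβ lastBlockβ ≡ map colOf Qr
  blueHeads≡ = trans (blueHeads-build (headsOf b) (headsOf r) length-headsOf) (cong (map colOf) (sym (freeRows≡ b)))

  redHeads≡ : redHeads blocksβ lastBlockβ ≡ map colOf Qb
  redHeads≡ = trans (redHeads-build (headsOf b) (headsOf r) length-headsOf) (cong (map colOf) (sym (freeRows≡ r)))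

  row-onβ : ∀ {w} → w ∈ Qr ⊎ w ∈ Qb → IsColumnLabel n k (colOf w) × rowOf (colOf w) ≡ w
  row-onβ w∈ = colOf-isColumnLabel roww , rowOf∘colOf roww
    where
    roww = rowsTopToBottom⇒isRowLabel n k ([ proj₁ ∘ ∈-filterᵇ⁻ _ rows , proj₁ ∘ ∈-filterᵇ⁻ _ rows ]′ w∈)

  rooks-onβ : ∀ {c w} → (c , w) ∈ rooks → IsColumnLabel n k c × rowOf c ≡ w
  rooks-onβ {c} {w} m with ∈-++⁻ (crossRooks blocksβ lastBlockβ Qr Qb) m
  ... | inj₁ mCross = subst (λ c → IsColumnLabel n k c × rowOf c ≡ w) (sym c≡) (row-onβ w∈)
    where
    onRow = ∈-crossRooks⇒onRow colOf blocksβ lastBlockβ Qr Qb blueHeads≡ redHeads≡ mCross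
    c≡ = proj₁ onRow
    w∈ = proj₂ onRow
  ... | inj₂ m₁ with ∈-allChainRooks⁻ csβ (∈-↭ rooks₁↭ m₁)
  ... | (a , xs) , ch∈ , q∈ = IsChainFrom-rooks a xs (proj₂ (proj₂ (csβ-facts ch∈))) q∈

-- Any decomposition whose rooks all lie on β is the one read off β.
module DecodingUnique {n k : ℕ} (β : AdmissibleBijection n k) (es : List Block) (f : LastBlock) (dec : IsDecomposition n k es f)
  (rooks-onβ : ∀ {c w} → (c , w) ∈ OnDecomposition.rooks n k es f dec → AdmissibleBijection.rowOf β c ≡ w) where
  open AdmissibleBijection β
  open ChainsOf β
  open Decoding β using (headsOf; blocksβ; lastBlockβ; freeRows≡crossingRows)
  open BuildBlocks chainFrom
  open OnDecomposition n k es f dec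

  colOf-rook : ∀ {c w} → (c , w) ∈ rooks → colOf w ≡ c
  colOf-rook m = trans (cong colOf (sym (rooks-onβ m))) (colOf∘rowOf (IsFullPlacement.cols⇒ rooks-isFull (∈-map⁺ proj₁ m)))

  rookInRow : ∀ {w} → IsRowLabel n k w → (colOf w , w) ∈ rooks
  rookInRow {w} roww with ∈-map⁻ proj₁ (IsFullPlacement.cols⇐ rooks-isFull (colOf-isColumnLabel roww))
  ... | (c , w') , m , refl = subst (λ z → (c , z) ∈ rooks) (trans (sym (rooks-onβ m)) (rowOf∘colOf roww)) m

  rooks₁-sameColor : ∀ {c w} → (c , w) ∈ rooks₁ → color c ≡ color w
  rooks₁-sameColor {c} {w} m = chainStep-color w c (allChainRooks-step cs chainsOK (∈-↭ rooks₁↭ m))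

  rowOccupied⇔continues : ∀ {w} → IsRowLabel n k w → rowOccupied w rooks₁ ≡ true ⇔ Continues w
  rowOccupied⇔continues {w} roww = mk⇔ to from
    where
    to : rowOccupied w rooks₁ ≡ true → Continues w
    to occ with ∈-map⁻ proj₂ (rowOccupied⇒∈ w rooks₁ occ)
    ... | (c , w) , m , refl = roww , subst (λ z → color z ≡ color w) (sym (colOf-rook (∈-++⁺ʳ _ m))) (rooks₁-sameColor m)
    from : Continues w → rowOccupied w rooks₁ ≡ true
    from (_ , same) with ∈-++⁻ (crossRooks es f Qr Qb) (rookInRow roww)
    ... | inj₁ mCross = ⊥-elim (crossRook-colors≢ mCross same)
    ... | inj₂ m = ∈⇒rowOccupied w rooks₁ (∈-map⁺ proj₂ m)

  heads≡ : map colOf Qr ≡ blueHeads es f × map colOf Qb ≡ redHeads es f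
  heads≡ = crossRooks-onRow⇒heads colOf es f Qr Qb length-Qr length-Qb (colOf-rook ∘ ∈-++⁺ˡ)

  chains-haveTailOf : All HasTailOf cs
  chains-haveTailOf = tabulate λ {(a , xs)} m →
    IsChainFrom-unique a xs (chainFrom a) (isChainFrom-chain m) (chainFrom-isChainFrom a (chainLetters⇒letter (∈-chainLetters⁺ cs m (here refl))))
    where
    isChainFrom-chain : ∀ {a xs} → (a , xs) ∈ cs → IsChainFrom a xs
    isChainFrom-chain {a} {xs} m = isChainFrom a xs (lookup chainsOK m) onβ lastStops
      where
      onβ : ∀ {c w} → (c , w) ∈ chainRooks (a ∷ xs) → IsColumnLabel n k c × rowOf c ≡ w
      onβ q∈ = IsFullPlacement.cols⇒ rooks-isFull (∈-map⁺ proj₁ rook∈) , rooks-onβ rook∈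
        where rook∈ = ∈-++⁺ʳ (crossRooks es f Qr Qb) (∈-↭ (↭-sym rooks₁↭) (∈-allChainRooks⁺ cs m q∈))
      lastStops : ¬ Continues (chainLast a xs)
      lastStops cont = lasts∉inits (∈-map⁺ _ m)
        (∈-↭ rooks₁-rows (rowOccupied⇒∈ _ rooks₁ (Equivalence.from (rowOccupied⇔continues (proj₁ cont)) cont)))

  decoded≡ : blocksβ ≡ es × lastBlockβ ≡ f
  decoded≡ with build-heads es f chains-haveTailOf
  ... | es≡ , f≡ = trans (cong₂ buildBlocks headsb≡ headsr≡) es≡ , trans (cong₂ buildLastBlock headsb≡ headsr≡) f≡
    where
    headsb≡ : headsOf b ≡ blueHeads es f
    headsb≡ = trans (cong (map colOf) (sym (freeRows≡crossingRows b rooks₁ rowOccupied⇔continues))) (proj₁ heads≡)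
    headsr≡ : headsOf r ≡ redHeads es f
    headsr≡ = trans (cong (map colOf) (sym (freeRows≡crossingRows r rooks₁ rowOccupied⇔continues))) (proj₂ heads≡)

JoinDecreasing : List Sym → List Sym → Set
JoinDecreasing [] ys = ⊤
JoinDecreasing (x ∷ []) [] = ⊤
JoinDecreasing (x ∷ []) (y ∷ _) = AdjDecr x y
JoinDecreasing (x ∷ x' ∷ xs) ys = JoinDecreasing (x' ∷ xs) ys

runsDecreasing-++ : ∀ xs ys → RunsDecreasing xs → RunsDecreasing ys → JoinDecreasing xs ys → RunsDecreasing (xs ++ ys)
runsDecreasing-++ [] ys _ rd _ = rd
runsDecreasing-++ (x ∷ []) [] _ _ _ = tt
runsDecreasing-++ (x ∷ []) (y ∷ ys) _ rd join = join , rd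
runsDecreasing-++ (x ∷ x' ∷ xs) ys (d , rd) rd' join = d , runsDecreasing-++ (x' ∷ xs) ys rd rd' join

runsDecreasing-++ˡ : ∀ xs ys → RunsDecreasing (xs ++ ys) → RunsDecreasing xs
runsDecreasing-++ˡ [] ys _ = tt
runsDecreasing-++ˡ (x ∷ []) ys _ = tt
runsDecreasing-++ˡ (x ∷ x' ∷ xs) ys (d , rd) = d , runsDecreasing-++ˡ (x' ∷ xs) ys rd

runsDecreasing-++ʳ : ∀ xs ys → RunsDecreasing (xs ++ ys) → RunsDecreasing ys
runsDecreasing-++ʳ [] ys rd = rd
runsDecreasing-++ʳ (x ∷ []) [] _ = tt
runsDecreasing-++ʳ (x ∷ []) (y ∷ ys) (_ , rd) = rd
runsDecreasing-++ʳ (x ∷ x' ∷ xs) ys (_ , rd) = runsDecreasing-++ʳ (x' ∷ xs) ys rd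

runsDecreasing-adjacent : ∀ p x y q → RunsDecreasing (p ++ x ∷ y ∷ q) → AdjDecr x y
runsDecreasing-adjacent [] x y q (d , _) = d
runsDecreasing-adjacent (z ∷ []) x y q (_ , rd) = runsDecreasing-adjacent [] x y q rd
runsDecreasing-adjacent (z ∷ z' ∷ p) x y q (_ , rd) = runsDecreasing-adjacent (z' ∷ p) x y q rd

runsDecreasing-∷ʳ : ∀ zs y x → RunsDecreasing (zs ∷ʳ y) → AdjDecr y x → RunsDecreasing (zs ++ y ∷ x ∷ [])
runsDecreasing-∷ʳ [] y x _ d = d , tt
runsDecreasing-∷ʳ (z ∷ []) y x (d₁ , _) d = d₁ , d , tt
runsDecreasing-∷ʳ (z ∷ z' ∷ zs) y x (d₁ , rd) d = d₁ , runsDecreasing-∷ʳ (z' ∷ zs) y x rd d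

adjDecr-colors≢ : ∀ x y → color x ≢ color y → AdjDecr x y
adjDecr-colors≢ (red x) (red y) x≢y = ⊥-elim (x≢y refl)
adjDecr-colors≢ (red x) (blue y) _ = tt
adjDecr-colors≢ (blue x) (red y) _ = tt
adjDecr-colors≢ (blue x) (blue y) x≢y = ⊥-elim (x≢y refl)

joinDecreasing-colors≢ : ∀ c xs ys → AllColored c xs → HeadNotColored c ys → JoinDecreasing xs ys
joinDecreasing-colors≢ c [] ys _ _ = tt
joinDecreasing-colors≢ c (x ∷ []) [] _ _ = tt
joinDecreasing-colors≢ c (x ∷ []) (y ∷ ys) (cx ∷ _) hn = adjDecr-colors≢ x y (λ e → hn (trans (sym e) cx))
joinDecreasing-colors≢ c (x ∷ x' ∷ xs) ys (_ ∷ cxs) hn = joinDecreasing-colors≢ c (x' ∷ xs) ys cxs hn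

joinDecreasing-++ : ∀ xs ys zs → ys ≢ [] → JoinDecreasing ys zs → JoinDecreasing (xs ++ ys) zs
joinDecreasing-++ [] ys zs _ join = join
joinDecreasing-++ (x ∷ []) [] zs ys≢[] _ = ⊥-elim (ys≢[] refl)
joinDecreasing-++ (x ∷ []) (y ∷ ys) zs _ join = join
joinDecreasing-++ (x ∷ x' ∷ xs) ys zs ys≢[] join = joinDecreasing-++ (x' ∷ xs) ys zs ys≢[] join

blueRun⇒chain : ∀ xs → AllColored b xs → RunsDecreasing xs → IsChain xs
blueRun⇒chain [] _ _ = tt
blueRun⇒chain (x ∷ []) _ _ = tt
blueRun⇒chain (blue x ∷ blue y ∷ ys) (_ ∷ cys) (d , rd) = d , blueRun⇒chain (blue y ∷ ys) cys rd
blueRun⇒chain (blue x ∷ red y ∷ ys) (_ ∷ () ∷ _) _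

IsChain-∷ʳ : ∀ zs y x → IsChain (zs ∷ʳ y) → ChainStep y x → IsChain (zs ++ y ∷ x ∷ [])
IsChain-∷ʳ [] y x _ s = s , tt
IsChain-∷ʳ (z ∷ []) y x (s₁ , _) s = s₁ , s , tt
IsChain-∷ʳ (z ∷ z' ∷ zs) y x (s₁ , ok) s = s₁ , IsChain-∷ʳ (z' ∷ zs) y x ok s

redRun⇒reversedChain : ∀ xs → AllColored r xs → RunsDecreasing xs → IsChain (reverse xs)
redRun⇒reversedChain [] _ _ = tt
redRun⇒reversedChain (x ∷ []) _ _ = tt
redRun⇒reversedChain (red x ∷ red y ∷ ys) (_ ∷ cys) (d , rd) =
  subst IsChain (sym (reverse-∷∷ (red x) (red y) ys))
    (IsChain-∷ʳ (reverse ys) (red y) (red x) (subst IsChain (unfold-reverse (red y) ys) (redRun⇒reversedChain (red y ∷ ys) cys rd)) d)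
redRun⇒reversedChain (red x ∷ blue y ∷ ys) (_ ∷ () ∷ _) _

blueChain⇒runsDecreasing : ∀ x xs → color x ≡ b → IsChain (x ∷ xs) → RunsDecreasing (x ∷ xs)
blueChain⇒runsDecreasing x [] _ _ = tt
blueChain⇒runsDecreasing (blue x) (blue y ∷ ys) _ (s , ok) = s , blueChain⇒runsDecreasing (blue y) ys refl ok

redChain⇒reversedRunsDecreasing : ∀ x xs → color x ≡ r → IsChain (x ∷ xs) → RunsDecreasing (reverse (x ∷ xs))
redChain⇒reversedRunsDecreasing x [] _ _ = tt
redChain⇒reversedRunsDecreasing (red x) (red y ∷ ys) _ (s , ok) =
  subst RunsDecreasing (sym (reverse-∷∷ (red x) (red y) ys))
    (runsDecreasing-∷ʳ (reverse ys) (red y) (red x)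
      (subst RunsDecreasing (unfold-reverse (red y) ys) (redChain⇒reversedRunsDecreasing (red y) ys refl ok)) s)

splitRun : ∀ c x xs → color x ≡ c → Σ (List Sym) λ bs → Σ (List Sym) λ rest →
  x ∷ xs ≡ (x ∷ bs) ++ rest × AllColored c (x ∷ bs) × HeadNotColored c rest
splitRun c x [] cx = [] , [] , refl , cx ∷ [] , tt
splitRun c x (y ∷ ys) cx with color y ≟C c
... | no cy≢c = [] , y ∷ ys , refl , cx ∷ [] , cy≢c
... | yes cy with splitRun c y ys cy
... | bs , rest , e , cbs , hn = y ∷ bs , rest , cong (x ∷_) e , cx ∷ cbs , hn

EndsIn : Sym → List Sym → Set
EndsIn z w = Σ (List Sym) λ u → w ≡ u ∷ʳ z

EndsIn-++ʳ : ∀ z (p q : List Sym) → EndsIn z (p ++ q) → q ≢ [] → EndsIn z q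
EndsIn-++ʳ z [] q end _ = end
EndsIn-++ʳ z (x ∷ p) q ([] , e) q≢[] = ⊥-elim (q≢[] (++-conicalʳ p q (proj₂ (∷-injective e))))
EndsIn-++ʳ z (x ∷ p) q (y ∷ u , e) q≢[] = EndsIn-++ʳ z p q (u , proj₂ (∷-injective e)) q≢[]

reverse-∷-view : ∀ (x : Sym) xs → Σ Sym λ l → Σ (List Sym) λ rs → reverse (x ∷ xs) ≡ l ∷ rs
reverse-∷-view x xs with reverse (x ∷ xs) | reverse-∷≢[] x xs
... | [] | ne = ⊥-elim (ne refl)
... | l ∷ rs | _ = l , rs , refl

blueRun-chain : ∀ x bs R → AllColored b (x ∷ bs) → RunsDecreasing ((x ∷ bs) ++ R) → IsChain (x ∷ bs)
blueRun-chain x bs R cbs rd = blueRun⇒chain (x ∷ bs) cbs (runsDecreasing-++ˡ (x ∷ bs) R rd)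

lastBlock-ofRuns : ∀ x bs R → color x ≡ b → AllColored b (x ∷ bs) → AllColored r R →
  RunsDecreasing ((x ∷ bs) ++ R) → EndsIn (red 0) R → Σ LastBlock λ f → IsLastBlock f × word [] f ≡ (x ∷ bs) ++ R
lastBlock-ofRuns x bs R cx cbs cR rd (R' , eR) = lastBlock x bs (reverse R') , (cx , blueRun-chain x bs R cbs rd , chainR) , wordEq
  where
  chainR : IsChain (red 0 ∷ reverse R')
  chainR = subst IsChain (trans (cong reverse eR) (reverse-++ R' (red 0 ∷ [])))
             (redRun⇒reversedChain R cR (runsDecreasing-++ʳ (x ∷ bs) R rd))
  wordEq : word [] (lastBlock x bs (reverse R')) ≡ (x ∷ bs) ++ R
  wordEq = cong (λ z → x ∷ bs ++ z)
    (trans (unfold-reverse (red 0) (reverse R')) (trans (cong (_∷ʳ red 0) (reverse-involutive R')) (sym eR)))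

block-ofRuns : ∀ x bs R rest → R ≢ [] → color x ≡ b → AllColored b (x ∷ bs) → AllColored r R →
  RunsDecreasing ((x ∷ bs) ++ R ++ rest) → Σ Block λ e → IsBlock e × blockWord e ++ rest ≡ (x ∷ bs) ++ R ++ rest
block-ofRuns x bs [] rest R≢[] = ⊥-elim (R≢[] refl)
block-ofRuns x bs R@(y ∷ rs₀) rest _ cx cbs cR rd with reverse-∷-view y rs₀
... | l , rs , eRev = block x bs l rs , (cx , cl , blueRun-chain x bs (R ++ rest) cbs rd , chainR) , wordEq
  where
  chainR : IsChain (l ∷ rs)
  chainR = subst IsChain eRev (redRun⇒reversedChain R cR (runsDecreasing-++ˡ R rest (runsDecreasing-++ʳ (x ∷ bs) _ rd)))
  cl : color l ≡ r
  cl with subst (AllColored r) eRev (All-reverse R cR)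
  ... | c ∷ _ = c
  wordEq : blockWord (block x bs l rs) ++ rest ≡ (x ∷ bs) ++ R ++ rest
  wordEq = begin
      (x ∷ bs ++ reverse (l ∷ rs)) ++ rest ≡⟨ cong (λ q → (x ∷ bs ++ q) ++ rest) (trans (cong reverse (sym eRev)) (reverse-involutive R)) ⟩
      ((x ∷ bs) ++ R) ++ rest              ≡⟨ ++-assoc (x ∷ bs) R rest ⟩
      (x ∷ bs) ++ R ++ rest ∎
    where open ≡-Reasoning

peelBlock : ∀ x xs → color x ≡ b → RunsDecreasing (x ∷ xs) → EndsIn (red 0) (x ∷ xs) →
  (Σ LastBlock λ f → IsLastBlock f × word [] f ≡ x ∷ xs) ⊎
  (Σ Block λ e → Σ Sym λ z → Σ (List Sym) λ zs → IsBlock e × color z ≡ b × blockWord e ++ z ∷ zs ≡ x ∷ xs)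
peelBlock x xs cx rd (u , eu) with splitRun b x xs cx
... | bs , [] , e₁ , cbs , _ = ⊥-elim (notAllBlue u (subst (AllColored b) (trans (trans (sym (++-identityʳ (x ∷ bs))) (sym e₁)) eu) cbs))
  where
  notAllBlue : ∀ u → ¬ AllColored b (u ∷ʳ red 0)
  notAllBlue [] (() ∷ _)
  notAllBlue (_ ∷ u) (_ ∷ cu) = notAllBlue u cu
... | bs , y ∷ ys , e₁ , cbs , hn₁ with splitRun r y ys (≢∧≢⇒≡ hn₁ b≢r)
... | rs₀ , [] , e₂ , crs , _ =
  let R = y ∷ rs₀
      eW = trans e₁ (cong ((x ∷ bs) ++_) (trans e₂ (++-identityʳ R)))
      (f , okf , wordEq) = lastBlock-ofRuns x bs R cx cbs crs (subst RunsDecreasing eW rd)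
                             (EndsIn-++ʳ (red 0) (x ∷ bs) R (u , trans (sym eW) eu) (λ ()))
  in inj₁ (f , okf , trans wordEq (sym eW))
... | rs₀ , z ∷ zs , e₂ , crs , hn₂ =
  let eW = trans e₁ (cong ((x ∷ bs) ++_) e₂)
      (e , oke , wordEq) = block-ofRuns x bs (y ∷ rs₀) (z ∷ zs) (λ ()) cx cbs crs (subst RunsDecreasing eW rd)
  in inj₂ (e , z , zs , oke , ≢∧≢⇒≡ hn₂ r≢b , trans wordEq (sym eW))

parseBlocks : ∀ fuel x xs → length xs < fuel → color x ≡ b → RunsDecreasing (x ∷ xs) → EndsIn (red 0) (x ∷ xs) →
  Σ (List Block) λ es → Σ LastBlock λ f → word es f ≡ x ∷ xs × All IsBlock es × IsLastBlock f
parseBlocks (suc fuel) x xs lt cx rd end with peelBlock x xs cx rd end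
... | inj₁ (f , okf , wordEq) = [] , f , wordEq , [] , okf
... | inj₂ (e@(block t bs l rs) , z , zs , oke , cz , wordEq)
  with parseBlocks fuel z zs shorter cz (runsDecreasing-++ʳ (blockWord e) (z ∷ zs) (subst RunsDecreasing (sym wordEq) rd))
                   (EndsIn-++ʳ (red 0) (blockWord e) (z ∷ zs) (subst (EndsIn (red 0)) (sym wordEq) end) (λ ()))
  where
  xs≡ : xs ≡ (bs ++ reverse (l ∷ rs)) ++ z ∷ zs
  xs≡ = sym (proj₂ (∷-injective wordEq))
  shorter : length zs < fuel
  shorter = ≤-trans (≤-trans (m≤n+m (suc (length zs)) (length p))
                            (≤-reflexive (trans (sym (length-++ p)) (cong length (sym xs≡)))))
                    (s≤s⁻¹ lt)
    where p = bs ++ reverse (l ∷ rs)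
... | es , f , wordEq' , oks , okf = e ∷ es , f , trans (cong (blockWord e ++_) wordEq') wordEq , oke ∷ oks , okf

module _ (n k : ℕ) where

  alphabet⇒letter : ∀ {z} → z ∈ alphabet n k → IsLetter n k z × z ≢ red 0 × z ≢ blue 0
  alphabet⇒letter m with ∈-++⁻ (map (λ i → red (suc i)) (upTo n)) m
  ... | inj₁ m₁ with ∈-map⁻ (λ i → red (suc i)) m₁
  ... | i , i∈ , refl = ∈-upTo⁻ i∈ , (λ ()) , (λ ())
  alphabet⇒letter m | inj₂ m₂ with ∈-map⁻ (λ j → blue (suc j)) m₂
  ... | j , j∈ , refl = ∈-upTo⁻ j∈ , (λ ()) , (λ ())

  letter⇒alphabet : ∀ {z} → IsLetter n k z → z ≢ red 0 → z ≢ blue 0 → z ∈ alphabet n k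
  letter⇒alphabet {red zero} _ z≢0 _ = ⊥-elim (z≢0 refl)
  letter⇒alphabet {red (suc x)} ok _ _ = ∈-++⁺ˡ (∈-map⁺ (λ i → red (suc i)) (∈-upTo⁺ ok))
  letter⇒alphabet {blue zero} _ _ z≢0 = ⊥-elim (z≢0 refl)
  letter⇒alphabet {blue (suc x)} ok _ _ = ∈-++⁺ʳ (map (λ i → red (suc i)) (upTo n)) (∈-map⁺ (λ j → blue (suc j)) (∈-upTo⁺ ok))

  Unique-alphabet : Unique (alphabet n k)
  Unique-alphabet = Unique-++ (Unique.map⁺ (suc-injective ∘ red-injective) (Unique.upTo⁺ n))
                              (Unique.map⁺ (suc-injective ∘ blue-injective) (Unique.upTo⁺ k)) disjoint
    where
    disjoint : ∀ {z} → z ∈ map (λ i → red (suc i)) (upTo n) → z ∈ map (λ j → blue (suc j)) (upTo k) → ⊥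
    disjoint m₁ m₂ with ∈-map⁻ (λ i → red (suc i)) m₁ | ∈-map⁻ (λ j → blue (suc j)) m₂
    ... | _ , _ , refl | _ , _ , ()

  letters↭ : ∀ {w} → w ↭ blue 0 ∷ red 0 ∷ alphabet n k → ∀ {z} → IsLetter n k z → z ∈ w
  letters↭ w↭ {z} ok with z ≟S blue 0 | z ≟S red 0
  ... | yes refl | _ = ∈-↭ (↭-sym w↭) (here refl)
  ... | no _ | yes refl = ∈-↭ (↭-sym w↭) (there (here refl))
  ... | no z≢b0 | no z≢r0 = ∈-↭ (↭-sym w↭) (there (there (letter⇒alphabet ok z≢r0 z≢b0)))

fullWord : List Sym → List Sym → List Sym
fullWord S₁ S₂ = S₁ ++ blue 0 ∷ S₂ ++ red 0 ∷ []

fullWord↭ : ∀ S₁ S₂ → fullWord S₁ S₂ ↭ blue 0 ∷ red 0 ∷ (S₁ ++ S₂)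
fullWord↭ S₁ S₂ = begin
    S₁ ++ blue 0 ∷ S₂ ++ red 0 ∷ []      ↭⟨ shift (blue 0) S₁ (S₂ ++ red 0 ∷ []) ⟩
    blue 0 ∷ S₁ ++ S₂ ++ red 0 ∷ []      ≡⟨ cong (blue 0 ∷_) (sym (++-assoc S₁ S₂ (red 0 ∷ []))) ⟩
    blue 0 ∷ (S₁ ++ S₂) ++ red 0 ∷ []    ↭⟨ prep (blue 0) (shift (red 0) (S₁ ++ S₂) []) ⟩
    blue 0 ∷ red 0 ∷ (S₁ ++ S₂) ++ []    ≡⟨ cong (λ z → blue 0 ∷ red 0 ∷ z) (++-identityʳ (S₁ ++ S₂)) ⟩
    blue 0 ∷ red 0 ∷ (S₁ ++ S₂) ∎
  where open PermutationReasoning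

joinDecreasing-blue0 : ∀ xs ys → blue 0 ∉ xs → JoinDecreasing xs (blue 0 ∷ ys)
joinDecreasing-blue0 [] ys _ = tt
joinDecreasing-blue0 (red x ∷ []) ys _ = tt
joinDecreasing-blue0 (blue zero ∷ []) ys 0∉ = ⊥-elim (0∉ (here refl))
joinDecreasing-blue0 (blue (suc x) ∷ []) ys _ = s≤s z≤n
joinDecreasing-blue0 (x ∷ x' ∷ xs) ys 0∉ = joinDecreasing-blue0 (x' ∷ xs) ys (0∉ ∘ there)

joinDecreasing-red0 : ∀ xs → red 0 ∉ xs → JoinDecreasing xs (red 0 ∷ [])
joinDecreasing-red0 [] _ = tt
joinDecreasing-red0 (blue x ∷ []) _ = tt
joinDecreasing-red0 (red zero ∷ []) 0∉ = ⊥-elim (0∉ (here refl))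
joinDecreasing-red0 (red (suc x) ∷ []) _ = s≤s z≤n
joinDecreasing-red0 (x ∷ x' ∷ xs) 0∉ = joinDecreasing-red0 (x' ∷ xs) (0∉ ∘ there)

joinDecreasing-blue0-red : ∀ S → StartsWith r S → JoinDecreasing (blue 0 ∷ []) (S ++ red 0 ∷ [])
joinDecreasing-blue0-red [] _ = tt
joinDecreasing-blue0-red (red y ∷ _) _ = tt

runsDecreasing-fullWord : ∀ S₁ S₂ → blue 0 ∉ S₁ → red 0 ∉ S₂ → StartsWith r S₂ →
  RunsDecreasing S₁ → RunsDecreasing S₂ → RunsDecreasing (fullWord S₁ S₂)
runsDecreasing-fullWord S₁ S₂ b0∉ r0∉ sr rd₁ rd₂ =
  runsDecreasing-++ S₁ _ rd₁ (runsDecreasing-++ (blue 0 ∷ []) _ tt rdS₂r0 (joinDecreasing-blue0-red S₂ sr)) (joinDecreasing-blue0 S₁ _ b0∉)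
  where
  rdS₂r0 = runsDecreasing-++ S₂ (red 0 ∷ []) rd₂ tt (joinDecreasing-red0 S₂ r0∉)

decompose : ∀ n k S₁ S₂ → InC n k S₁ S₂ →
  Σ (List Block) λ es → Σ LastBlock λ f → IsDecomposition n k es f × word es f ≡ fullWord S₁ S₂
decompose n k S₁ S₂ (perm , sb , sr , rd₁ , rd₂) with start S₁ sb
  where
  start : ∀ T → StartsWith b T → Σ Sym λ x → Σ (List Sym) λ xs → fullWord T S₂ ≡ x ∷ xs × color x ≡ b
  start [] _ = blue 0 , S₂ ++ red 0 ∷ [] , refl , refl
  start (x ∷ xs) cx = x , xs ++ blue 0 ∷ S₂ ++ red 0 ∷ [] , refl , cx
... | x , xs , ew , cx with parseBlocks (suc (length xs)) x xs ≤-refl cx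
         (subst RunsDecreasing ew (runsDecreasing-fullWord S₁ S₂ b0∉S₁ r0∉S₂ sr rd₁ rd₂))
         (S₁ ++ blue 0 ∷ S₂ , trans (sym ew) (sym (++-assoc S₁ (blue 0 ∷ S₂) (red 0 ∷ []))))
  where
  b0∉S₁ : blue 0 ∉ S₁
  b0∉S₁ m = proj₂ (proj₂ (alphabet⇒letter n k (∈-↭ perm (∈-++⁺ˡ m)))) refl
  r0∉S₂ : red 0 ∉ S₂
  r0∉S₂ m = proj₁ (proj₂ (alphabet⇒letter n k (∈-↭ perm (∈-++⁺ʳ S₁ m)))) refl
... | es , f , wordEq , oks , okf = es , f , dec , word≡
  where
  word≡ : word es f ≡ fullWord S₁ S₂
  word≡ = trans wordEq (sym ew)
  w↭ : word es f ↭ blue 0 ∷ red 0 ∷ alphabet n k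
  w↭ = ↭-trans (↭-reflexive word≡) (↭-trans (fullWord↭ S₁ S₂) (prep (blue 0) (prep (red 0) perm)))
  dec : IsDecomposition n k es f
  dec = record
    { blocksOK = oks
    ; lastBlockOK = okf
    ; uniqueLetters = Unique-↭ (↭-sym w↭)
        (Unique-cons (λ { (here ()) ; (there m) → proj₂ (proj₂ (alphabet⇒letter n k m)) refl })
          (Unique-cons (λ m → proj₁ (proj₂ (alphabet⇒letter n k m)) refl) (Unique-alphabet n k)))
    ; letters⇒ = letter ∘ ∈-↭ w↭
    ; letters⇐ = letters↭ n k w↭
    }
    where
    letter : ∀ {z} → z ∈ blue 0 ∷ red 0 ∷ alphabet n k → IsLetter n k z
    letter (here refl) = z≤n
    letter (there (here refl)) = z≤n
    letter (there (there m)) = proj₁ (alphabet⇒letter n k m)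

runsDecreasing-word : ∀ es f → All IsBlock es → IsLastBlock f → RunsDecreasing (word es f)
runsDecreasing-word [] (lastBlock t bs rs) _ (ct , okb , okr) =
  runsDecreasing-++ (t ∷ bs) (reverse (red 0 ∷ rs)) (blueChain⇒runsDecreasing t bs ct okb) (redChain⇒reversedRunsDecreasing (red 0) rs refl okr)
    (joinDecreasing-colors≢ b (t ∷ bs) _ (blueChain-colored t bs ct okb)
      (subst (HeadNotColored b) (++-identityʳ _)
        (HeadNotColored-++ b r (reverse (red 0 ∷ rs)) [] (reversedRedChain-colored (red 0) rs refl okr) r≢b (λ _ → tt))))
runsDecreasing-word (block t bs l rs ∷ es) f ((ct , cl , okb , okr) ∷ oks) okf =
  runsDecreasing-++ ((t ∷ bs) ++ redRun) (word es f)
    (runsDecreasing-++ (t ∷ bs) redRun (blueChain⇒runsDecreasing t bs ct okb) (redChain⇒reversedRunsDecreasing l rs cl okr)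
      (joinDecreasing-colors≢ b (t ∷ bs) _ (blueChain-colored t bs ct okb)
        (subst (HeadNotColored b) (++-identityʳ redRun)
          (HeadNotColored-++ b r redRun [] redColored r≢b (⊥-elim ∘ reverse-∷≢[] l rs)))))
    (runsDecreasing-word es f oks okf)
    (joinDecreasing-++ (t ∷ bs) redRun (word es f) (reverse-∷≢[] l rs)
      (joinDecreasing-colors≢ r redRun (word es f) redColored (wordHead-notRed es f oks okf)))
  where
  redRun = reverse (l ∷ rs)
  redColored = reversedRedChain-colored l rs cl okr

word-startsBlue : ∀ es f → All IsBlock es → IsLastBlock f → ∀ {x xs} → word es f ≡ x ∷ xs → color x ≡ b
word-startsBlue [] (lastBlock t bs rs) _ (ct , _) refl = ct
word-startsBlue (block t bs l rs ∷ es) f ((ct , _) ∷ _) _ refl = ct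

compose : ∀ n k es f → IsDecomposition n k es f →
  Σ (List Sym) λ S₁ → Σ (List Sym) λ S₂ → InC n k S₁ S₂ × word es f ≡ fullWord S₁ S₂
compose n k es f dec with ∈-∃++ (IsDecomposition.letters⇐ dec {blue 0} z≤n)
... | S₁ , q , eq₁ with EndsIn-++ʳ (red 0) S₁ (blue 0 ∷ q) (wordInit es f , trans (sym eq₁) (word≡wordInit∷ʳred0 es f)) (λ ())
... | [] , ()
... | _ ∷ S₂ , eq₂ = S₁ , S₂ , (perm , startsBlue S₁ word≡ , startsRed S₂ rdW , runsDecreasing-++ˡ S₁ _ rdW ,
                              runsDecreasing-++ˡ S₂ (red 0 ∷ []) (runsDecreasing-++ʳ (blue 0 ∷ []) _ (runsDecreasing-++ʳ S₁ _ rdW))) , word≡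
  where
  open IsDecomposition dec
  word≡ : word es f ≡ fullWord S₁ S₂
  word≡ = trans eq₁ (cong (λ z → S₁ ++ blue 0 ∷ z) (proj₂ (∷-injective eq₂)))
  w↭ : word es f ↭ blue 0 ∷ red 0 ∷ (S₁ ++ S₂)
  w↭ = ↭-trans (↭-reflexive word≡) (fullWord↭ S₁ S₂)
  u₀ : Unique (blue 0 ∷ red 0 ∷ (S₁ ++ S₂))
  u₀ = Unique-↭ w↭ uniqueLetters
  perm : (S₁ ++ S₂) ↭ alphabet n k
  perm = Unique⇒↭ (Unique-tail (Unique-tail u₀)) (Unique-alphabet n k) to from
    where
    to : ∀ {z} → z ∈ S₁ ++ S₂ → z ∈ alphabet n k
    to m = letter⇒alphabet n k (letters⇒ (∈-↭ (↭-sym w↭) (there (there m))))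
             (λ { refl → Unique[x∷xs]⇒x∉xs (Unique-tail u₀) m }) (λ { refl → Unique[x∷xs]⇒x∉xs u₀ (there m) })
    from : ∀ {z} → z ∈ alphabet n k → z ∈ S₁ ++ S₂
    from m with alphabet⇒letter n k m
    ... | ok , z≢r0 , z≢b0 with ∈-↭ w↭ (letters⇐ ok)
    ... | here e = ⊥-elim (z≢b0 e)
    ... | there (here e) = ⊥-elim (z≢r0 e)
    ... | there (there m') = m'
  rdW : RunsDecreasing (fullWord S₁ S₂)
  rdW = subst RunsDecreasing word≡ (runsDecreasing-word es f blocksOK lastBlockOK)
  startsBlue : ∀ T → word es f ≡ T ++ blue 0 ∷ S₂ ++ red 0 ∷ [] → StartsWith b T
  startsBlue [] _ = tt
  startsBlue (x ∷ T) e = word-startsBlue es f blocksOK lastBlockOK e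
  startsRed : ∀ T → RunsDecreasing (S₁ ++ blue 0 ∷ T ++ red 0 ∷ []) → StartsWith r T
  startsRed [] _ = tt
  startsRed (red y ∷ T) _ = refl
  startsRed (blue y ∷ T) rd with runsDecreasing-adjacent S₁ (blue 0) (blue y) (T ++ red 0 ∷ []) rd
  ... | ()

procedure-decomposition : ∀ n k es f (dec : IsDecomposition n k es f) S₁ S₂ → word es f ≡ fullWord S₁ S₂ →
  procedure n k S₁ S₂ ≡ just (OnDecomposition.rooks n k es f dec)
procedure-decomposition n k es f dec S₁ S₂ word≡ =
  trans (cong₂ (λ u v → step2 (rowsTopToBottom n k) u (step1 v)) (sym wordInit≡) (sym word≡)) (OnDecomposition.step2-word n k es f dec)
  where
  wordInit≡ : wordInit es f ≡ S₁ ++ blue 0 ∷ S₂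
  wordInit≡ = ∷ʳ-injectiveˡ (wordInit es f) (S₁ ++ blue 0 ∷ S₂)
    (trans (sym (word≡wordInit∷ʳred0 es f)) (trans word≡ (sym (++-assoc S₁ (blue 0 ∷ S₂) (red 0 ∷ [])))))

admissibleBijection : ∀ n k (π : Permutation′ (suc (n + k))) →
  (∀ {c} → IsColumnLabel n k c → Admissible c (OnLabels.rowOfπ n k π c)) → AdmissibleBijection n k
admissibleBijection n k π adm = record
  { rowOf = rowOfπ
  ; colOf = colOfπ
  ; rowOf-isRowLabel = λ {c} _ → rowLabel-isRowLabel n k (π ⟨$⟩ʳ colIndex n k c)
  ; colOf-isColumnLabel = λ {w} _ → colLabel-isColumnLabel n k (π ⟨$⟩ˡ rowIndex n k w)
  ; colOf∘rowOf = colOfπ-rowOfπ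
  ; rowOf∘colOf = rowOfπ-colOfπ
  ; admissible = adm
  }
  where open OnLabels n k π

fullWord-injective : ∀ S₁ S₂ T₁ T₂ → blue 0 ∉ S₁ → blue 0 ∉ T₁ → fullWord S₁ S₂ ≡ fullWord T₁ T₂ → S₁ ≡ T₁ × S₂ ≡ T₂
fullWord-injective [] S₂ [] T₂ _ _ e = refl , ∷ʳ-injectiveˡ S₂ T₂ (proj₂ (∷-injective e))
fullWord-injective [] S₂ (x ∷ T₁) T₂ _ b0∉ e = ⊥-elim (b0∉ (here (proj₁ (∷-injective e))))
fullWord-injective (x ∷ S₁) S₂ [] T₂ b0∉ _ e = ⊥-elim (b0∉ (here (sym (proj₁ (∷-injective e)))))
fullWord-injective (x ∷ S₁) S₂ (y ∷ T₁) T₂ b0∉ b0∉' e with ∷-injective e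
... | refl , e' with fullWord-injective S₁ S₂ T₁ T₂ (b0∉ ∘ there) (b0∉' ∘ there) e'
... | S₁≡ , S₂≡ = cong (x ∷_) S₁≡ , S₂≡

module _ (n k : ℕ) where

  rooks↭graph : ∀ S₁ S₂ π es f (dec : IsDecomposition n k es f) → word es f ≡ fullWord S₁ S₂ → Produces n k S₁ S₂ π →
                OnDecomposition.rooks n k es f dec ↭ graph n k π
  rooks↭graph S₁ S₂ π es f dec word≡ (P , run , P↭) =
    subst (_↭ graph n k π) (just-injective (trans (sym run) (procedure-decomposition n k es f dec S₁ S₂ word≡))) P↭

  blue0∉S₁ : ∀ {S₁ S₂} → InC n k S₁ S₂ → blue 0 ∉ S₁
  blue0∉S₁ (perm , _) m = proj₂ (proj₂ (alphabet⇒letter n k (∈-↭ perm (∈-++⁺ˡ m)))) refl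

  procedure-wellDefined : (S₁ S₂ : List Sym) → InC n k S₁ S₂ →
    Σ (Permutation′ (suc (n + k))) λ π → InE n k π × Produces n k S₁ S₂ π
  procedure-wellDefined S₁ S₂ c with decompose n k S₁ S₂ c
  ... | es , f , dec , word≡ with fullPlacement⇒permutation n k (OnDecomposition.rooks n k es f dec) (OnDecomposition.rooks-isFull n k es f dec)
  ... | π , π∈E , rooks↭ = π , π∈E , OnDecomposition.rooks n k es f dec , procedure-decomposition n k es f dec S₁ S₂ word≡ , rooks↭

  -- Both decompositions have their rooks on the graph of π, so both are the one read off π.
  procedure-injective : (S₁ S₂ T₁ T₂ : List Sym) (π : Permutation′ (suc (n + k))) → InC n k S₁ S₂ → InC n k T₁ T₂ →
    Produces n k S₁ S₂ π → Produces n k T₁ T₂ π → S₁ ≡ T₁ × S₂ ≡ T₂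
  procedure-injective S₁ S₂ T₁ T₂ π cS cT runS runT with decompose n k S₁ S₂ cS | decompose n k T₁ T₂ cT
  ... | esS , fS , decS , wordS | esT , fT , decT , wordT =
    fullWord-injective S₁ S₂ T₁ T₂ (blue0∉S₁ cS) (blue0∉S₁ cT)
      (trans (sym wordS) (trans (cong₂ word (trans (sym (proj₁ decodedS)) (proj₁ decodedT)) (trans (sym (proj₂ decodedS)) (proj₂ decodedT))) wordT))
    where
    open OnLabels n k π
    graphS = rooks↭graph S₁ S₂ π esS fS decS wordS runS
    β = admissibleBijection n k π λ ok →
      IsFullPlacement.admissibleRooks (OnDecomposition.rooks-isFull n k esS fS decS) (∈-↭ (↭-sym graphS) (∈graph⇐ ok))
    decodedS = DecodingUnique.decoded≡ β esS fS decS (proj₂ ∘ ∈graph⇒ ∘ ∈-↭ graphS)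
    decodedT = DecodingUnique.decoded≡ β esT fT decT (proj₂ ∘ ∈graph⇒ ∘ ∈-↭ (rooks↭graph T₁ T₂ π esT fT decT wordT runT))

  procedure-surjective : (π : Permutation′ (suc (n + k))) → InE n k π →
    Σ (List Sym) λ S₁ → Σ (List Sym) λ S₂ → InC n k S₁ S₂ × Produces n k S₁ S₂ π
  procedure-surjective π π∈E = S₁ , S₂ , inC , rooks , procedure-decomposition n k es f dec S₁ S₂ word≡ ,
    OnLabels.↭graph n k π rooks (IsFullPlacement.uniqueCols rooks-isFull) (IsFullPlacement.cols⇐ rooks-isFull) onGraph
    where
    β = admissibleBijection n k π (OnLabels.admissible n k π π∈E)
    es = Decoding.blocksβ β
    f = Decoding.lastBlockβ β
    dec = Decoding.isDecomposition β
    open OnDecomposition n k es f dec using (rooks; rooks-isFull)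
    composed = compose n k es f dec
    S₁ = proj₁ composed
    S₂ = proj₁ (proj₂ composed)
    inC = proj₁ (proj₂ (proj₂ composed))
    word≡ = proj₂ (proj₂ (proj₂ composed))
    onGraph : ∀ {q} → q ∈ rooks → q ∈ graph n k π
    onGraph {c , w} m = subst (λ z → (c , z) ∈ graph n k π) (proj₂ (Decoding.rooks-onβ β m)) (OnLabels.∈graph⇐ n k π (proj₁ (Decoding.rooks-onβ β m)))

theorem4p6 : (n k : ℕ) →
    -- well-defined map C_n^k → E_n^k
    ((S₁ S₂ : List Sym) → InC n k S₁ S₂ →
      Σ (Permutation′ (suc (n + k))) λ π → InE n k π × Produces n k S₁ S₂ π)
    -- injective
    × ((S₁ S₂ T₁ T₂ : List Sym) (π : Permutation′ (suc (n + k))) →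
      InC n k S₁ S₂ → InC n k T₁ T₂ →
      Produces n k S₁ S₂ π → Produces n k T₁ T₂ π → (S₁ ≡ T₁ × S₂ ≡ T₂))
    -- surjective
    × ((π : Permutation′ (suc (n + k))) → InE n k π →
      Σ (List Sym) λ S₁ → Σ (List Sym) λ S₂ → InC n k S₁ S₂ × Produces n k S₁ S₂ π)
theorem4p6 n k = procedure-wellDefined n k , procedure-injective n k , procedure-surjective n k
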